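{- Let $k\geq2$, let $\mathcal{H}\subseteq\mathsf{UT}(n,\mathbb{Q})$, and let $C_1,\ldots,C_{k+1}\in\mathfrak{L}_{\geq1}(\log\mathcal{H})$ with $\sum_{i=1}^{k+1}C_i\in\mathfrak{L}_{\geq2}(\log\mathcal{H})$. If $S$ is a set partition of $\{1,\ldots,k\}$ having a block of cardinality $1$, then $\sum_{S'\succcurlyeq S}\Phi(S')\in\mathfrak{L}_{\geq k+1}(\log\mathcal{H})$, where the sum is over all coarsenings $S'$ of $S$.
   Context: $\mathsf{UT}(n,\mathbb{Q})$: upper unitriangular rational $n\times n$ matrices; $\mathfrak{u}(n)$: strictly upper triangular rational matrices, $[X,Y]=XY-YX$; $\log A=\sum_{j=1}^n\frac{(-1)^{j-1}}{j}(A-I)^j$; $\log\mathcal{H}=\{\log A\mid A\in\mathcal{H}\}$. For $\mathcal{S}\subseteq\mathfrak{u}(n)$: $[\mathcal{S}]_1=\mathcal{S}$, $[\mathcal{S}]_j=\{[\ldots[[X_1,X_2],X_3],\ldots,X_j]\mid X_i\in\mathcal{S}\}$, $\mathfrak{L}_{\geq j}(\mathcal{S})$ is the $\mathbb{Q}$-span of $\bigcup_{i\geq j}[\mathcal{S}]_i$. A set partition of $\{1,\ldots,k\}$ is a set of non-empty pairwise disjoint blocks with union $\{1,\ldots,k\}$; $S'\succcurlyeq S$ ($S'$ is a coarsening of $S$) if every block of $S$ is contained in a block of $S'$. For $\tau\in\operatorname{S}_k$ (symmetric group on $\{1,\ldots,k\}$), $d(\tau)$ is the number of $i\in\{1,\ldots,k-1\}$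 with $\tau(i)>\tau(i+1)$. Define $\varphi_k(X_1,\ldots,X_k)=\sum_{\tau\in\operatorname{S}_k}\frac{(-1)^{d(\tau)}}{k^2\binom{k-1}{d(\tau)}}[\ldots[[X_{\tau(1)},X_{\tau(2)}],X_{\tau(3)}],\ldots,X_{\tau(k)}]$. For $\boldsymbol{j}=(j_1,\ldots,j_k)\in\{1,\ldots,k+1\}^k$, $\operatorname{SP}(\boldsymbol{j})$ is the set of non-empty sets $\{l\mid j_l=i\}$, $i=1,\ldots,k+1$, and $\Phi(\boldsymbol{j})=\frac{1}{(k+1-\operatorname{card}(\operatorname{SP}(\boldsymbol{j})))!}\sum_{\sigma\in\operatorname{S}_{k+1}}\varphi_k(C_{\sigma(j_1)},\ldots,C_{\sigma(j_k)})$; it depends only on $\operatorname{SP}(\boldsymbol{j})$, and $\Phi(S):=\Phi(\boldsymbol{j})$ for any $\boldsymbol{j}$ with $\operatorname{SP}(\boldsymbol{j})=S$. -}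

module Defs where

open import Data.Nat as ℕ using (ℕ; zero; suc; _≤_; _<ᵇ_; _!)
open import Data.Nat.Combinatorics using () renaming (_C_ to binom)
open import Data.Integer as ℤ using (ℤ; +_)
open import Data.Rational as ℚ using (ℚ; 0ℚ; 1ℚ)
open import Data.Fin as Fin using (Fin; toℕ)
open import Data.Fin.Properties using (_≟_)
open import Data.Bool using (Bool; true; false; if_then_else_; _∧_; _∨_; not)
open import Data.List as List using (List; []; _∷_; foldr; foldl; map; filter; allFin; concatMap; length)
open import Data.Product using (Σ; ∃; _×_; _,_)
open import Relation.Nullary.Decidable using (⌊_⌋)
open import Relation.Binary.PropositionalEquality using (_≡_)

-- division of a rational by a natural number; the value at 0 is junk
-- (never used: all denominators below are positive)
_÷ℕ_ : ℚ → ℕ → ℚ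
q ÷ℕ zero    = 0ℚ
q ÷ℕ (suc m) = q ℚ.* ((+ 1) ℚ./ suc m)

sign : ℕ → ℚ
sign zero    = 1ℚ
sign (suc m) = ℚ.- sign m

Mat : ℕ → Set
Mat n = Fin n → Fin n → ℚ

_≈ₘ_ : ∀ {n} → Mat n → Mat n → Set
A ≈ₘ B = ∀ i j → A i j ≡ B i j

sumFin : ∀ m → (Fin m → ℚ) → ℚ
sumFin zero    f = 0ℚ
sumFin (suc m) f = f Fin.zero ℚ.+ sumFin m (λ i → f (Fin.suc i))

0ₘ : ∀ {n} → Mat n
0ₘ i j = 0ℚ

Iₘ : ∀ {n} → Mat n
Iₘ i j = if ⌊ i ≟ j ⌋ then 1ℚ else 0ℚ

_+ₘ_ : ∀ {n} → Mat n → Mat n → Mat n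
(A +ₘ B) i j = A i j ℚ.+ B i j

_-ₘ_ : ∀ {n} → Mat n → Mat n → Mat n
(A -ₘ B) i j = A i j ℚ.- B i j

_·ₘ_ : ∀ {n} → ℚ → Mat n → Mat n
(c ·ₘ A) i j = c ℚ.* A i j

_*ₘ_ : ∀ {n} → Mat n → Mat n → Mat n
_*ₘ_ {n} A B i j = sumFin n (λ l → A i l ℚ.* B l j)

_^ₘ_ : ∀ {n} → Mat n → ℕ → Mat n
A ^ₘ zero  = Iₘ
A ^ₘ suc m = A *ₘ (A ^ₘ m)

⁅_,_⁆ : ∀ {n} → Mat n → Mat n → Mat n
⁅ X , Y ⁆ = (X *ₘ Y) -ₘ (Y *ₘ X)

sumₘ : ∀ {n} → List (Mat n) → Mat n
sumₘ = foldr _+ₘ_ 0ₘ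

sumFinₘ : ∀ {n} m → (Fin m → Mat n) → Mat n
sumFinₘ m C = sumₘ (map C (allFin m))

IsUT : ∀ {n} → Mat n → Set
IsUT A = (∀ i → A i i ≡ 1ℚ) × (∀ i j → toℕ j ℕ.< toℕ i → A i j ≡ 0ℚ)

logₘ : ∀ {n} → Mat n → Mat n
logₘ {n} A = sumₘ (map term (List.upTo n))
  where
  term : ℕ → Mat n
  term m = (sign m ÷ℕ suc m) ·ₘ ((A -ₘ Iₘ) ^ₘ suc m)

Log : ∀ {n} → (Mat n → Set) → Mat n → Set
Log 𝓗 X = Σ _ λ A → 𝓗 A × (X ≈ₘ logₘ A)

data Bracket {n} (𝓢 : Mat n → Set) : ℕ → Mat n → Set where
  base : ∀ {X} → 𝓢 X → Bracket 𝓢 1 X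
  step : ∀ {j Y Z} → Bracket 𝓢 j Y → 𝓢 Z → Bracket 𝓢 (suc j) ⁅ Y , Z ⁆

data LinComb {n} (P : Mat n → Set) : Mat n → Set where
  nil  : LinComb P 0ₘ
  cons : ∀ {Y Z} (c : ℚ) → P Y → LinComb P Z → LinComb P ((c ·ₘ Y) +ₘ Z)

InL≥ : ∀ {n} → (Mat n → Set) → ℕ → Mat n → Set
InL≥ 𝓢 j X = Σ _ λ Z → LinComb (λ Y → ∃ λ i → j ≤ i × Bracket 𝓢 i Y) Z × (X ≈ₘ Z)

allFuns : ∀ m p → List (Fin m → Fin p)
allFuns zero    p = (λ ()) ∷ []
allFuns (suc m) p =
  concatMap (λ a → map (λ f → λ { Fin.zero → a ; (Fin.suc i) → f i }) (allFuns m p))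
            (allFin p)

allB : ∀ {A : Set} → (A → Bool) → List A → Bool
allB P xs = foldr (λ x b → P x ∧ b) true xs

anyB : ∀ {A : Set} → (A → Bool) → List A → Bool
anyB P xs = foldr (λ x b → P x ∨ b) false xs

isInjective : ∀ {m} → (Fin m → Fin m) → Bool
isInjective {m} f =
  allB (λ a → allB (λ b → not ⌊ f a ≟ f b ⌋ ∨ ⌊ a ≟ b ⌋) (allFin m)) (allFin m)

perms : ∀ m → List (Fin m → Fin m)
perms m = filter (λ f → Data.Bool.T? (isInjective f)) (allFuns m m)
  where import Data.Bool

descList : List ℕ → ℕ
descList []             = 0
descList (a ∷ [])       = 0
descList (a ∷ b ∷ rest) = (if b <ᵇ a then 1 else 0) ℕ.+ descList (b ∷ rest)

descents : ∀ {k} → (Fin k → Fin k) → ℕ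
descents {k} τ = descList (map (λ i → toℕ (τ i)) (allFin k))

lbr : ∀ {n} → List (Mat n) → Mat n
lbr []       = 0ₘ
lbr (X ∷ Xs) = foldl ⁅_,_⁆ X Xs

φ : ∀ {n} k → (Fin k → Mat n) → Mat n
φ {n} k X = sumₘ (map term (perms k))
  where
  term : (Fin k → Fin k) → Mat n
  term τ = (sign (descents τ) ÷ℕ (k ℕ.* k ℕ.* (binom (k ℕ.∸ 1) (descents τ))))
             ·ₘ lbr (map (λ i → X (τ i)) (allFin k))

cardSP : ∀ {k p} → (Fin k → Fin p) → ℕ
cardSP {k} {p} j =
  length (filter (λ a → Data.Bool.T? (anyB (λ l → ⌊ j l ≟ a ⌋) (allFin k))) (allFin p))
  where import Data.Bool

-- Φ(j) for j ∈ {1,…,k+1}^k (0-indexed: j : Fin k → Fin (k+1))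
Φ : ∀ {n} k → (Fin (suc k) → Mat n) → (Fin k → Fin (suc k)) → Mat n
Φ {n} k C j =
  (1ℚ ÷ℕ ((suc k ℕ.∸ cardSP j) !))
    ·ₘ sumₘ (map (λ σ → φ k (λ l → C (σ (j l)))) (perms (suc k)))

coarseningB : ∀ {k} → (Fin k → Fin (suc k)) → (Fin k → Fin (suc k)) → Bool
coarseningB {k} j′ j =
  allB (λ a → allB (λ b → not ⌊ j a ≟ j b ⌋ ∨ ⌊ j′ a ≟ j′ b ⌋) (allFin k)) (allFin k)

-- a labeling is canonical (restricted growth) if each label is either a
-- label already used at an earlier position or the smallest unused one;
-- canonical labelings are in bijection with set partitions via SP
canonicalB : ∀ {k} → (Fin k → Fin (suc k)) → Bool
canonicalB {k} j = allB ok (allFin k)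
  where
  earlier : Fin k → List (Fin k)
  earlier l = filter (λ m → toℕ m ℕ.<? toℕ l) (allFin k)
  ok : Fin k → Bool
  ok l = anyB (λ m → ⌊ j m ≟ j l ⌋) (earlier l)
       ∨ ⌊ toℕ (j l) ℕ.≟ length (filter (λ a → Data.Bool.T? (anyB (λ m → ⌊ j m ≟ a ⌋) (earlier l))) (allFin (suc k))) ⌋
    where import Data.Bool

-- one canonical labeling for each set partition S' ≽ SP(j)
coarsenings : ∀ k → (Fin k → Fin (suc k)) → List (Fin k → Fin (suc k))
coarsenings k j =
  filter (λ j′ → Data.Bool.T? (canonicalB j′ ∧ coarseningB j′ j)) (allFuns k (suc k))
  where import Data.Bool

coarseningSum : ∀ {n} k → (Fin (suc k) → Mat n) → (Fin k → Fin (suc k)) → Mat n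
coarseningSum k C j = sumₘ (map (Φ k C) (coarsenings k j))

HasSingletonBlock : ∀ {k p} → (Fin k → Fin p) → Set
HasSingletonBlock {k} j = ∃ λ (l : Fin k) → ∀ m → j m ≡ j l → m ≡ l

-- Expanding Φ entrywise, the sum of Φ(S′) over the coarsenings S′ ≽ S becomes a sum of
-- φ_k(C_{f 1}, …, C_{f k}) over all labelings f : {1..k} → {1..k+1} whose kernel coarsens S:
-- each such f is σ ∘ g for its restricted-growth form g and exactly (k+1−|S′|)! permutations σ,
-- which cancels the factor 1/(k+1−|S′|)! in Φ(S′).  If {l} is a singleton block of S, the label
-- f l is unconstrained, so the sum regroups into sums over i of φ_k with C_i as argument l.
-- As φ_k is multilinear, each of its left-normed brackets then carries Σ_i C_i ∈ 𝔏_{≥2} in one slot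
-- and elements of 𝔏_{≥1} in the k−1 others; since [𝔏_{≥a}, 𝔏_{≥b}] ⊆ 𝔏_{≥a+b} by the Jacobi
-- identity, every such bracket lies in 𝔏_{≥k+1}.

module Submission where

open import Defs
open import Data.Nat as ℕ using (ℕ; zero; suc; _≤_; _<_; _∸_; z≤n; s≤s; _!)
open import Data.Nat.Combinatorics using () renaming (_C_ to binom)
import Data.Nat.Properties as ℕP
open import Data.Rational as ℚ using (ℚ; 0ℚ; 1ℚ; _+_; _*_; -_; _-_; _/_; toℚᵘ)
import Data.Rational.Properties as ℚP
import Data.Rational.Solver as ℚSolver
import Data.Integer.Solver as ℤSolver
import Data.Integer as ℤ
import Data.Rational.Unnormalised as ℚᵘ
import Data.Rational.Unnormalised.Properties as ℚᵘP
open import Data.Nat.Coprimality using (1-coprimeTo)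
open import Data.Fin as Fin using (Fin; toℕ)
open import Data.Fin.Properties using (_≟_)
import Data.Fin.Properties
open import Data.Bool using (Bool; true; false; _∧_; _∨_; not; T; T?)
import Data.Bool.Properties as BoolP
open import Data.Maybe using (Maybe; just; nothing; is-just)
open import Data.Unit using (tt)
open import Data.Empty using (⊥; ⊥-elim)
open import Data.Sum using (_⊎_; inj₁; inj₂)
open import Data.Product using (∃; _×_; _,_; proj₁; proj₂)
open import Data.List.Relation.Unary.All as All using (All)
import Data.List.Relation.Unary.All.Properties as AllP
import Data.List.Relation.Unary.AllPairs as AllPairs
open import Data.List.Relation.Unary.Any using (here; there)
open import Data.List.Relation.Unary.Unique.Propositional using (Unique)
import Data.List.Relation.Unary.Unique.Propositional.Properties as UniqueP
open import Data.List.Membership.Propositional using (_∈_; _∉_)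
open import Data.List.Membership.Propositional.Properties using (∈-map⁺; ∈-allFin; ∈-filter⁻)
open import Data.List as List using (List; []; _∷_; _++_; map; filter; concatMap; tabulate; allFin; foldl; length)
open import Relation.Nullary using (yes; no; does; ¬_; ¬?)
open import Relation.Binary using (tri<; tri≈; tri>)
open import Relation.Nullary.Decidable using (⌊_⌋; toWitness; fromWitness; decidable-stable)
open import Relation.Unary using (Pred; Decidable)
open import Relation.Binary.PropositionalEquality
import Data.List.Properties as ListP
import Data.Vec.Functional as Vec
import Data.Vec.Functional.Properties as VecP
open import Algebra.Bundles using (Ring)
open import Algebra.Properties.Semiring.Mult (Ring.semiring ℚP.+-*-ring) using (×1-homo-*) renaming (_×_ to _×ℚ_)
open import Function using (_∘_; Equivalence)


∑ : ∀ {A : Set} → List A → (A → ℚ) → ℚ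
∑ []       f = 0ℚ
∑ (x ∷ xs) f = f x + ∑ xs f

𝟙 : Bool → ℚ
𝟙 true  = 1ℚ
𝟙 false = 0ℚ

module _ {A : Set} where

  ∑-cong : ∀ (xs : List A) {f g : A → ℚ} → f ≗ g → ∑ xs f ≡ ∑ xs g
  ∑-cong []       f≗g = refl
  ∑-cong (x ∷ xs) f≗g = cong₂ _+_ (f≗g x) (∑-cong xs f≗g)

  ∑-zero : ∀ (xs : List A) {f : A → ℚ} → (∀ x → f x ≡ 0ℚ) → ∑ xs f ≡ 0ℚ
  ∑-zero []       f≡0 = refl
  ∑-zero (x ∷ xs) f≡0 = trans (cong₂ _+_ (f≡0 x) (∑-zero xs f≡0)) (ℚP.+-identityˡ 0ℚ)

  ∑-+ : ∀ (xs : List A) (f g : A → ℚ) → ∑ xs (λ x → f x + g x) ≡ ∑ xs f + ∑ xs g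
  ∑-+ []       f g = refl
  ∑-+ (x ∷ xs) f g = trans (cong (f x + g x +_) (∑-+ xs f g))
    (solve 4 (λ a b c d → (a :+ b) :+ (c :+ d) := (a :+ c) :+ (b :+ d)) refl (f x) (g x) (∑ xs f) (∑ xs g))
    where open ℚSolver.+-*-Solver

  ∑-neg : ∀ (xs : List A) (f : A → ℚ) → - ∑ xs f ≡ ∑ xs (λ x → - f x)
  ∑-neg []       f = refl
  ∑-neg (x ∷ xs) f = trans (ℚP.neg-distrib-+ (f x) (∑ xs f)) (cong (- f x +_) (∑-neg xs f))

  ∑-*ˡ : ∀ (xs : List A) (c : ℚ) (f : A → ℚ) → c * ∑ xs f ≡ ∑ xs (λ x → c * f x)
  ∑-*ˡ []       c f = ℚP.*-zeroʳ c
  ∑-*ˡ (x ∷ xs) c f = trans (ℚP.*-distribˡ-+ c (f x) (∑ xs f)) (cong (c * f x +_) (∑-*ˡ xs c f))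

  ∑-*ʳ : ∀ (xs : List A) (c : ℚ) (f : A → ℚ) → ∑ xs f * c ≡ ∑ xs (λ x → f x * c)
  ∑-*ʳ xs c f = trans (ℚP.*-comm (∑ xs f) c) (trans (∑-*ˡ xs c f) (∑-cong xs (λ x → ℚP.*-comm c (f x))))

  ∑-++ : ∀ (xs ys : List A) (f : A → ℚ) → ∑ (xs ++ ys) f ≡ ∑ xs f + ∑ ys f
  ∑-++ []       ys f = sym (ℚP.+-identityˡ _)
  ∑-++ (x ∷ xs) ys f = trans (cong (f x +_) (∑-++ xs ys f)) (sym (ℚP.+-assoc (f x) (∑ xs f) (∑ ys f)))

  ∑-filter : ∀ {p} {P : Pred A p} (P? : Decidable P) (xs : List A) (f : A → ℚ) →
             ∑ (filter P? xs) f ≡ ∑ xs (λ x → 𝟙 (does (P? x)) * f x)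
  ∑-filter P? []       f = refl
  ∑-filter P? (x ∷ xs) f with does (P? x)
  ... | false = trans (∑-filter P? xs f) (sym (trans (cong (_+ _) (ℚP.*-zeroˡ (f x))) (ℚP.+-identityˡ _)))
  ... | true  = cong₂ _+_ (sym (ℚP.*-identityˡ (f x))) (∑-filter P? xs f)

module _ {A B : Set} where

  ∑-map : ∀ (g : A → B) (xs : List A) (f : B → ℚ) → ∑ (map g xs) f ≡ ∑ xs (f ∘ g)
  ∑-map g []       f = refl
  ∑-map g (x ∷ xs) f = cong (f (g x) +_) (∑-map g xs f)

  ∑-concatMap : ∀ (g : A → List B) (xs : List A) (f : B → ℚ) →
                ∑ (concatMap g xs) f ≡ ∑ xs (λ x → ∑ (g x) f)
  ∑-concatMap g []       f = refl
  ∑-concatMap g (x ∷ xs) f = trans (∑-++ (g x) (concatMap g xs) f) (cong (∑ (g x) f +_) (∑-concatMap g xs f))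

  ∑-comm : ∀ (xs : List A) (ys : List B) (f : A → B → ℚ) →
           ∑ xs (λ x → ∑ ys (f x)) ≡ ∑ ys (λ y → ∑ xs (λ x → f x y))
  ∑-comm []       ys f = sym (∑-zero ys (λ _ → refl))
  ∑-comm (x ∷ xs) ys f = trans (cong (∑ ys (f x) +_) (∑-comm xs ys f))
    (sym (∑-+ ys (f x) (λ y → ∑ xs (λ x′ → f x′ y))))

sumFin-cong : ∀ n {f g : Fin n → ℚ} → f ≗ g → sumFin n f ≡ sumFin n g
sumFin-cong zero    f≗g = refl
sumFin-cong (suc n) f≗g = cong₂ _+_ (f≗g Fin.zero) (sumFin-cong n (f≗g ∘ Fin.suc))

∑-allFin : ∀ n (f : Fin n → ℚ) → ∑ (allFin n) f ≡ sumFin n f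
∑-allFin n f = go n (λ i → i)
  where
  go : ∀ m (g : Fin m → Fin n) → ∑ (tabulate g) f ≡ sumFin m (f ∘ g)
  go zero    g = refl
  go (suc m) g = cong (f (g Fin.zero) +_) (go m (g ∘ Fin.suc))

𝟙-∧ : ∀ a b → 𝟙 (a ∧ b) ≡ 𝟙 a * 𝟙 b
𝟙-∧ false b = sym (ℚP.*-zeroˡ (𝟙 b))
𝟙-∧ true  b = sym (ℚP.*-identityˡ (𝟙 b))

𝟙-false : ∀ {a} → ¬ T a → 𝟙 a ≡ 0ℚ
𝟙-false {false} _   = refl
𝟙-false {true}  ¬tt = ⊥-elim (¬tt tt)

T-ext : ∀ {a b} → (T a → T b) → (T b → T a) → a ≡ b
T-ext {false} {false} _ _ = refl
T-ext {false} {true}  _ g = ⊥-elim (g tt)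
T-ext {true}  {false} f _ = ⊥-elim (f tt)
T-ext {true}  {true}  _ _ = refl

∧⁻ : ∀ {a b} → T (a ∧ b) → T a × T b
∧⁻ = Equivalence.to BoolP.T-∧

∧⁺ : ∀ {a b} → T a → T b → T (a ∧ b)
∧⁺ ta tb = Equivalence.from BoolP.T-∧ (ta , tb)

∨⁻ : ∀ {a b} → T (a ∨ b) → T a ⊎ T b
∨⁻ = Equivalence.to BoolP.T-∨

∨⁺ˡ : ∀ {a b} → T a → T (a ∨ b)
∨⁺ˡ ta = Equivalence.from BoolP.T-∨ (inj₁ ta)

∨⁺ʳ : ∀ {a b} → T b → T (a ∨ b)
∨⁺ʳ tb = Equivalence.from BoolP.T-∨ (inj₂ tb)

T-not⇒¬T : ∀ {b} → T (not b) → ¬ T b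
T-not⇒¬T {false} _ ()

¬T⇒T-not : ∀ {b} → ¬ T b → T (not b)
¬T⇒T-not {false} _  = tt
¬T⇒T-not {true}  ¬t = ¬t tt

infix 4 _==_
_==_ : ∀ {n} → Fin n → Fin n → Bool
a == b = ⌊ a ≟ b ⌋

module _ {n : ℕ} where

  ==⇒≡ : {a b : Fin n} → T (a == b) → a ≡ b
  ==⇒≡ = toWitness

  ≡⇒== : {a b : Fin n} → a ≡ b → T (a == b)
  ≡⇒== = fromWitness

  ==-≢ : {a b : Fin n} → a ≢ b → (a == b) ≡ false
  ==-≢ {a} {b} a≢b with a ≟ b
  ... | yes a≡b = ⊥-elim (a≢b a≡b)
  ... | no  _   = refl

  ==-sym : (a b : Fin n) → (a == b) ≡ (b == a)
  ==-sym a b = T-ext (≡⇒== ∘ sym ∘ ==⇒≡) (≡⇒== ∘ sym ∘ ==⇒≡)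

==-suc : ∀ {n} (a b : Fin n) → (Fin.suc a == Fin.suc b) ≡ (a == b)
==-suc a b with a ≟ b
... | yes _ = refl
... | no  _ = refl

sumFin-delta : ∀ n (b : Fin n) (X : Fin n → ℚ) → sumFin n (λ a → 𝟙 (a == b) * X a) ≡ X b
sumFin-delta (suc n) Fin.zero X =
  trans (cong₂ _+_ (ℚP.*-identityˡ (X Fin.zero)) (off-diagonal n {X ∘ Fin.suc}))
        (ℚP.+-identityʳ (X Fin.zero))
  where
  off-diagonal : ∀ m {Y : Fin m → ℚ} → sumFin m (λ a → 𝟙 (Fin.suc a == Fin.zero) * Y a) ≡ 0ℚ
  off-diagonal zero        = refl
  off-diagonal (suc m) {Y} = trans (cong₂ _+_ (ℚP.*-zeroˡ (Y Fin.zero)) (off-diagonal m {Y ∘ Fin.suc})) (ℚP.+-identityˡ 0ℚ)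
sumFin-delta (suc n) (Fin.suc b) X =
  trans (cong₂ _+_ (ℚP.*-zeroˡ (X Fin.zero))
                   (trans (sumFin-cong n (λ a → cong (λ t → 𝟙 t * X (Fin.suc a)) (==-suc a b)))
                          (sumFin-delta n b (X ∘ Fin.suc))))
        (ℚP.+-identityˡ (X (Fin.suc b)))

∑-delta : ∀ n (b : Fin n) (X : Fin n → ℚ) → ∑ (allFin n) (λ a → 𝟙 (a == b) * X a) ≡ X b
∑-delta n b X = trans (∑-allFin n _) (sumFin-delta n b X)

Respects≗ : ∀ {m p} → ((Fin m → Fin p) → ℚ) → Set
Respects≗ G = ∀ {f g} → f ≗ g → G f ≡ G g

∑Fun : ∀ m p → ((Fin m → Fin p) → ℚ) → ℚ
∑Fun m p = ∑ (allFuns m p)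

module _ {m p : ℕ} where

  ∑Fun-cong : {G H : (Fin m → Fin p) → ℚ} → (∀ f → G f ≡ H f) → ∑Fun m p G ≡ ∑Fun m p H
  ∑Fun-cong = ∑-cong (allFuns m p)

∑Fun-suc : ∀ m p (G : (Fin (suc m) → Fin p) → ℚ) → Respects≗ G →
           ∑Fun (suc m) p G ≡ ∑ (allFin p) (λ a → ∑Fun m p (λ f → G (a Vec.∷ f)))
∑Fun-suc m p G G-resp = trans (∑-concatMap _ (allFin p) G)
  (∑-cong (allFin p) (λ a → trans (∑-map _ (allFuns m p) G)
     (∑-cong (allFuns m p) (λ f → G-resp (λ { Fin.zero → refl ; (Fin.suc i) → refl })))))

infix 4 _=ᶠ_
_=ᶠ_ : ∀ {m p} → (Fin m → Fin p) → (Fin m → Fin p) → Bool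
_=ᶠ_ {zero}  f g = true
_=ᶠ_ {suc m} f g = (f Fin.zero == g Fin.zero) ∧ (f ∘ Fin.suc =ᶠ g ∘ Fin.suc)

module _ {p : ℕ} where

  =ᶠ⇒≗ : ∀ {m} {f g : Fin m → Fin p} → T (f =ᶠ g) → f ≗ g
  =ᶠ⇒≗ {suc m} t Fin.zero    = ==⇒≡ (proj₁ (∧⁻ t))
  =ᶠ⇒≗ {suc m} t (Fin.suc i) = =ᶠ⇒≗ {m} (proj₂ (∧⁻ t)) i

  ≗⇒=ᶠ : ∀ {m} {f g : Fin m → Fin p} → f ≗ g → T (f =ᶠ g)
  ≗⇒=ᶠ {zero}  f≗g = tt
  ≗⇒=ᶠ {suc m} f≗g = ∧⁺ (≡⇒== (f≗g Fin.zero)) (≗⇒=ᶠ {m} (f≗g ∘ Fin.suc))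

  =ᶠ-congˡ : ∀ {m} {f f′ g : Fin m → Fin p} → f ≗ f′ → (f =ᶠ g) ≡ (f′ =ᶠ g)
  =ᶠ-congˡ f≗f′ = T-ext (λ t → ≗⇒=ᶠ (λ i → trans (sym (f≗f′ i)) (=ᶠ⇒≗ t i)))
                        (λ t → ≗⇒=ᶠ (λ i → trans (f≗f′ i) (=ᶠ⇒≗ t i)))

∑Fun-delta : ∀ m p (h : Fin m → Fin p) (G : (Fin m → Fin p) → ℚ) → Respects≗ G →
             ∑Fun m p (λ f → 𝟙 (f =ᶠ h) * G f) ≡ G h
∑Fun-delta zero    p h G G-resp = trans (ℚP.+-identityʳ _) (trans (ℚP.*-identityˡ _) (G-resp {g = h} (λ ())))
∑Fun-delta (suc m) p h G G-resp = begin
  ∑Fun (suc m) p (λ f → 𝟙 (f =ᶠ h) * G f)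
    ≡⟨ ∑Fun-suc m p (λ f → 𝟙 (f =ᶠ h) * G f) (λ f≗g → cong₂ _*_ (cong 𝟙 (=ᶠ-congˡ {g = h} f≗g)) (G-resp f≗g)) ⟩
  ∑ (allFin p) (λ a → ∑Fun m p (λ f → 𝟙 ((a Vec.∷ f) =ᶠ h) * G (a Vec.∷ f)))
    ≡⟨ ∑-cong (allFin p) sift-tail ⟩
  ∑ (allFin p) (λ a → 𝟙 (a == h Fin.zero) * G (a Vec.∷ (h ∘ Fin.suc)))
    ≡⟨ ∑-delta p (h Fin.zero) _ ⟩
  G (h Fin.zero Vec.∷ (h ∘ Fin.suc))
    ≡⟨ G-resp (λ { Fin.zero → refl ; (Fin.suc i) → refl }) ⟩
  G h ∎
  where
  open ≡-Reasoning
  sift-tail : ∀ a → ∑Fun m p (λ f → 𝟙 ((a Vec.∷ f) =ᶠ h) * G (a Vec.∷ f))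
                  ≡ 𝟙 (a == h Fin.zero) * G (a Vec.∷ (h ∘ Fin.suc))
  sift-tail a = begin
    ∑Fun m p (λ f → 𝟙 ((a Vec.∷ f) =ᶠ h) * G (a Vec.∷ f))
      ≡⟨ ∑Fun-cong (λ f → trans (cong (_* G (a Vec.∷ f)) (𝟙-∧ (a == h Fin.zero) _))
                                (ℚP.*-assoc (𝟙 (a == h Fin.zero)) _ _)) ⟩
    ∑Fun m p (λ f → 𝟙 (a == h Fin.zero) * (𝟙 (f =ᶠ h ∘ Fin.suc) * G (a Vec.∷ f)))
      ≡⟨ sym (∑-*ˡ (allFuns m p) (𝟙 (a == h Fin.zero)) (λ f → 𝟙 (f =ᶠ h ∘ Fin.suc) * G (a Vec.∷ f))) ⟩
    𝟙 (a == h Fin.zero) * ∑Fun m p (λ f → 𝟙 (f =ᶠ h ∘ Fin.suc) * G (a Vec.∷ f))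
      ≡⟨ cong (𝟙 (a == h Fin.zero) *_)
              (∑Fun-delta m p (h ∘ Fin.suc) (λ f → G (a Vec.∷ f))
                          (λ f≗g → G-resp (λ { Fin.zero → refl ; (Fin.suc i) → f≗g i }))) ⟩
    𝟙 (a == h Fin.zero) * G (a Vec.∷ (h ∘ Fin.suc)) ∎

𝟙ℕ : Bool → ℕ
𝟙ℕ true  = 1
𝟙ℕ false = 0

count : ∀ n → (Fin n → Bool) → ℕ
count zero    P = 0
count (suc n) P = 𝟙ℕ (P Fin.zero) ℕ.+ count n (P ∘ Fin.suc)

ℕ→ℚ : ℕ → ℚ
ℕ→ℚ n = n ×ℚ 1ℚ

ℕ→ℚ-𝟙ℕ-+ : ∀ b c → ℕ→ℚ (𝟙ℕ b ℕ.+ c) ≡ 𝟙 b + ℕ→ℚ c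
ℕ→ℚ-𝟙ℕ-+ true  c = refl
ℕ→ℚ-𝟙ℕ-+ false c = sym (ℚP.+-identityˡ _)

toℚᵘ-ℕ→ℚ : ∀ n → toℚᵘ (ℕ→ℚ n) ℚᵘ.≃ ℚᵘ.mkℚᵘ (ℤ.+ n) 0
toℚᵘ-ℕ→ℚ zero    = ℚᵘ.*≡* refl
toℚᵘ-ℕ→ℚ (suc n) = ℚᵘP.≃-trans (ℚP.toℚᵘ-homo-+ 1ℚ (ℕ→ℚ n))
  (ℚᵘP.≃-trans (ℚᵘP.+-congʳ (toℚᵘ 1ℚ) (toℚᵘ-ℕ→ℚ n))
    (ℚᵘ.*≡* (solve 1 (λ x → (con (ℤ.+ 1) :* con (ℤ.+ 1) :+ x :* con (ℤ.+ 1)) :* con (ℤ.+ 1)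
                          := (con (ℤ.+ 1) :+ x) :* (con (ℤ.+ 1) :* con (ℤ.+ 1))) refl (ℤ.+ n))))
  where open ℤSolver.+-*-Solver

÷ℕ-inverse : ∀ x → 1 ≤ x → (1ℚ ÷ℕ x) * ℕ→ℚ x ≡ 1ℚ
÷ℕ-inverse (suc t) _ = trans (cong (_* ℕ→ℚ (suc t)) (ℚP.*-identityˡ ((ℤ.+ 1) / suc t)))
  (ℚP.toℚᵘ-injective (ℚᵘP.≃-trans (ℚP.toℚᵘ-homo-* ((ℤ.+ 1) / suc t) (ℕ→ℚ (suc t)))
    (ℚᵘP.≃-trans (ℚᵘP.*-cong (ℚᵘP.≃-reflexive (cong toℚᵘ (ℚP.normalize-coprime (1-coprimeTo (suc t)))))
                             (toℚᵘ-ℕ→ℚ (suc t)))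
      (ℚᵘ.*≡* (solve 1 (λ x → (con (ℤ.+ 1) :* (con (ℤ.+ 1) :+ x)) :* con (ℤ.+ 1)
                            := con (ℤ.+ 1) :* ((con (ℤ.+ 1) :+ x) :* con (ℤ.+ 1))) refl (ℤ.+ t))))))
  where open ℤSolver.+-*-Solver

sumFin-𝟙 : ∀ n (P : Fin n → Bool) → sumFin n (𝟙 ∘ P) ≡ ℕ→ℚ (count n P)
sumFin-𝟙 zero    P = refl
sumFin-𝟙 (suc n) P = trans (cong (𝟙 (P Fin.zero) +_) (sumFin-𝟙 n (P ∘ Fin.suc)))
                           (sym (ℕ→ℚ-𝟙ℕ-+ (P Fin.zero) _))

count-cong : ∀ n {P Q : Fin n → Bool} → P ≗ Q → count n P ≡ count n Q
count-cong zero    P≗Q = refl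
count-cong (suc n) P≗Q = cong₂ ℕ._+_ (cong 𝟙ℕ (P≗Q Fin.zero)) (count-cong n (P≗Q ∘ Fin.suc))

count-false : ∀ n → count n (λ _ → false) ≡ 0
count-false zero    = refl
count-false (suc n) = count-false n

count-≤ : ∀ n P → count n P ≤ n
count-≤ zero    P = z≤n
count-≤ (suc n) P with P Fin.zero
... | true  = s≤s (count-≤ n (P ∘ Fin.suc))
... | false = ℕP.m≤n⇒m≤1+n (count-≤ n (P ∘ Fin.suc))

count-< : ∀ n (P : Fin n → Bool) a → P a ≡ false → count n P < n
count-< (suc n) P Fin.zero    Pa≡false rewrite Pa≡false = s≤s (count-≤ n (P ∘ Fin.suc))
count-< (suc n) P (Fin.suc a) Pa≡false with P Fin.zero
... | true  = s≤s (count-< n (P ∘ Fin.suc) a Pa≡false)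
... | false = ℕP.m≤n⇒m≤1+n (count-< n (P ∘ Fin.suc) a Pa≡false)

count-mono : ∀ n (P Q : Fin n → Bool) → (∀ i → T (P i) → T (Q i)) → count n P ≤ count n Q
count-mono zero    P Q P⇒Q = z≤n
count-mono (suc n) P Q P⇒Q with P Fin.zero in P0 | Q Fin.zero in Q0
... | true  | true  = s≤s (count-mono n _ _ (P⇒Q ∘ Fin.suc))
... | true  | false = ⊥-elim (subst T Q0 (P⇒Q Fin.zero (subst T (sym P0) tt)))
... | false | true  = ℕP.m≤n⇒m≤1+n (count-mono n _ _ (P⇒Q ∘ Fin.suc))
... | false | false = count-mono n _ _ (P⇒Q ∘ Fin.suc)

count-insert : ∀ n (P : Fin n → Bool) (b : Fin n) → P b ≡ false →
               count n (λ i → P i ∨ (i == b)) ≡ suc (count n P)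
count-insert (suc n) P Fin.zero Pb≡false rewrite Pb≡false =
  cong suc (count-cong n (λ i → BoolP.∨-identityʳ (P (Fin.suc i))))
count-insert (suc n) P (Fin.suc b) Pb≡false = begin
  𝟙ℕ (P Fin.zero ∨ false) ℕ.+ count n (λ i → P (Fin.suc i) ∨ (Fin.suc i == Fin.suc b))
    ≡⟨ cong₂ ℕ._+_ (cong 𝟙ℕ (BoolP.∨-identityʳ (P Fin.zero)))
                   (count-cong n (λ i → cong (P (Fin.suc i) ∨_) (==-suc i b))) ⟩
  𝟙ℕ (P Fin.zero) ℕ.+ count n (λ i → P (Fin.suc i) ∨ (i == b))
    ≡⟨ cong (𝟙ℕ (P Fin.zero) ℕ.+_) (count-insert n (P ∘ Fin.suc) b Pb≡false) ⟩
  𝟙ℕ (P Fin.zero) ℕ.+ suc (count n (P ∘ Fin.suc))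
    ≡⟨ ℕP.+-suc (𝟙ℕ (P Fin.zero)) _ ⟩
  suc (count (suc n) P) ∎
  where open ≡-Reasoning

count-∨-== : ∀ n (c : Bool) (b : Fin n) (P : Fin n → Bool) →
             count n (λ a → (c ∧ (b == a)) ∨ P a) ≡ 𝟙ℕ (c ∧ not (P b)) ℕ.+ count n P
count-∨-== n false b P = refl
count-∨-== n true  b P with P b in Pb
... | true  = count-cong n (λ a → T-ext (absorb a) ∨⁺ʳ)
  where
  absorb : ∀ a → T ((b == a) ∨ P a) → T (P a)
  absorb a t with ∨⁻ {b == a} t
  ... | inj₁ b==a = subst (T ∘ P) (==⇒≡ b==a) (subst T (sym Pb) tt)
  ... | inj₂ Pa   = Pa
... | false = trans (count-cong n (λ a → trans (BoolP.∨-comm (b == a) (P a)) (cong (P a ∨_) (==-sym b a))))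
                    (count-insert n P b Pb)

count-complement : ∀ n (A B : Fin n → Bool) → (∀ i → T (A i) → T (B i) → ⊥) →
                   count n (λ i → not (A i) ∧ not (B i)) ℕ.+ (count n A ℕ.+ count n B) ≡ n
count-complement zero    A B disj = refl
count-complement (suc n) A B disj with A Fin.zero in A0 | B Fin.zero in B0
... | true  | true  = ⊥-elim (disj Fin.zero (subst T (sym A0) tt) (subst T (sym B0) tt))
... | true  | false = trans (ℕP.+-suc _ _) (cong suc (count-complement n (A ∘ Fin.suc) (B ∘ Fin.suc) (disj ∘ Fin.suc)))
... | false | true  = trans (cong (count n (λ i → not (A (Fin.suc i)) ∧ not (B (Fin.suc i))) ℕ.+_)
                                  (ℕP.+-suc (count n (A ∘ Fin.suc)) _))
                            (trans (ℕP.+-suc _ _) (cong suc (count-complement n (A ∘ Fin.suc) (B ∘ Fin.suc) (disj ∘ Fin.suc))))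
... | false | false = cong suc (count-complement n (A ∘ Fin.suc) (B ∘ Fin.suc) (disj ∘ Fin.suc))

-- Counting injective extensions of a partial injection

fits : ∀ {N} → Maybe (Fin N) → Fin N → Bool
fits nothing  x = true
fits (just b) x = x == b

hits : ∀ {N} → Maybe (Fin N) → Fin N → Bool
hits nothing  y = false
hits (just b) y = b == y

image : ∀ {M N} → (Fin M → Maybe (Fin N)) → Fin N → Bool
image {zero}  ρ y = false
image {suc M} ρ y = hits (ρ Fin.zero) y ∨ image (ρ ∘ Fin.suc) y

domSize : ∀ {M N} → (Fin M → Maybe (Fin N)) → ℕ
domSize {M} ρ = count M (is-just ∘ ρ)

injExtB : ∀ {M N} → (Fin N → Bool) → (Fin M → Maybe (Fin N)) → (Fin M → Fin N) → Bool
injExtB {zero}  V ρ σ = true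
injExtB {suc M} V ρ σ =
  not (V (σ Fin.zero)) ∧ (fits (ρ Fin.zero) (σ Fin.zero) ∧
    injExtB (λ y → V y ∨ (y == σ Fin.zero)) (ρ ∘ Fin.suc) (σ ∘ Fin.suc))

falling : ℕ → ℕ → ℕ
falling x zero    = 1
falling x (suc m) = x ℕ.* falling (x ∸ 1) m

falling-n-n≡n! : ∀ n → falling n n ≡ n !
falling-n-n≡n! zero    = refl
falling-n-n≡n! (suc n) = cong (suc n ℕ.*_) (falling-n-n≡n! n)

module _ {N : ℕ} where

  image⇒∃ : ∀ {M} (ρ : Fin M → Maybe (Fin N)) y → T (image ρ y) → ∃ λ i → ρ i ≡ just y
  image⇒∃ {zero}  ρ y ()
  image⇒∃ {suc M} ρ y t with ρ Fin.zero in ρ0 | ∨⁻ {hits (ρ Fin.zero) y} t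
  ... | just b | inj₁ b==y = Fin.zero , trans ρ0 (cong just (==⇒≡ b==y))
  ... | _      | inj₂ t′   = let i , ρi≡y = image⇒∃ (ρ ∘ Fin.suc) y t′ in Fin.suc i , ρi≡y

  ∃⇒image : ∀ {M} (ρ : Fin M → Maybe (Fin N)) y i → ρ i ≡ just y → T (image ρ y)
  ∃⇒image {suc M} ρ y Fin.zero    ρ0≡y = ∨⁺ˡ (subst (λ c → T (hits c y)) (sym ρ0≡y) (≡⇒== refl))
  ∃⇒image {suc M} ρ y (Fin.suc i) ρi≡y = ∨⁺ʳ {hits (ρ Fin.zero) y} (∃⇒image (ρ ∘ Fin.suc) y i ρi≡y)

  injExtB-cong : ∀ {M} V ρ {σ τ : Fin M → Fin N} → σ ≗ τ → injExtB V ρ σ ≡ injExtB V ρ τ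
  injExtB-cong {zero}  V ρ σ≗τ = refl
  injExtB-cong {suc M} V ρ {σ} {τ} σ≗τ rewrite σ≗τ Fin.zero =
    cong (λ b → not (V (τ Fin.zero)) ∧ (fits (ρ Fin.zero) (τ Fin.zero) ∧ b))
         (injExtB-cong _ (ρ ∘ Fin.suc) (σ≗τ ∘ Fin.suc))

  private
    injExtB-tail : ∀ {M} V ρ (σ : Fin (suc M) → Fin N) → T (injExtB V ρ σ) →
                  T (injExtB (λ y → V y ∨ (y == σ Fin.zero)) (ρ ∘ Fin.suc) (σ ∘ Fin.suc))
    injExtB-tail V ρ σ t = proj₂ (∧⁻ (proj₂ (∧⁻ {not (V (σ Fin.zero))} t)))

  injExtB-avoids : ∀ {M} V ρ (σ : Fin M → Fin N) → T (injExtB V ρ σ) → ∀ i → ¬ T (V (σ i))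
  injExtB-avoids {suc M} V ρ σ t Fin.zero    = T-not⇒¬T (proj₁ (∧⁻ t))
  injExtB-avoids {suc M} V ρ σ t (Fin.suc i) Vσi =
    injExtB-avoids _ (ρ ∘ Fin.suc) (σ ∘ Fin.suc) (injExtB-tail V ρ σ t) i (∨⁺ˡ Vσi)

  injExtB-extends : ∀ {M} V ρ (σ : Fin M → Fin N) → T (injExtB V ρ σ) →
                   ∀ i b → ρ i ≡ just b → σ i ≡ b
  injExtB-extends {suc M} V ρ σ t Fin.zero    b ρ0≡b =
    ==⇒≡ (subst (λ c → T (fits c (σ Fin.zero))) ρ0≡b (proj₁ (∧⁻ (proj₂ (∧⁻ {not (V (σ Fin.zero))} t)))))
  injExtB-extends {suc M} V ρ σ t (Fin.suc i) b ρi≡b =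
    injExtB-extends _ (ρ ∘ Fin.suc) (σ ∘ Fin.suc) (injExtB-tail V ρ σ t) i b ρi≡b

  injExtB-injective : ∀ {M} V ρ (σ : Fin M → Fin N) → T (injExtB V ρ σ) →
                     ∀ i j → σ i ≡ σ j → i ≡ j
  injExtB-injective {suc M} V ρ σ t Fin.zero    Fin.zero    _ = refl
  injExtB-injective {suc M} V ρ σ t Fin.zero    (Fin.suc j) σ0≡σj =
    ⊥-elim (injExtB-avoids _ _ _ (injExtB-tail V ρ σ t) j (∨⁺ʳ {V (σ (Fin.suc j))} (≡⇒== (sym σ0≡σj))))
  injExtB-injective {suc M} V ρ σ t (Fin.suc i) Fin.zero    σi≡σ0 =
    ⊥-elim (injExtB-avoids _ _ _ (injExtB-tail V ρ σ t) i (∨⁺ʳ {V (σ (Fin.suc i))} (≡⇒== σi≡σ0)))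
  injExtB-injective {suc M} V ρ σ t (Fin.suc i) (Fin.suc j) σi≡σj =
    cong Fin.suc (injExtB-injective _ _ _ (injExtB-tail V ρ σ t) i j σi≡σj)

  injExtB-complete : ∀ {M} V ρ (σ : Fin M → Fin N) → (∀ i j → σ i ≡ σ j → i ≡ j) →
                    (∀ i → ¬ T (V (σ i))) → (∀ i b → ρ i ≡ just b → σ i ≡ b) → T (injExtB V ρ σ)
  injExtB-complete {zero}  V ρ σ σ-inj avoids extends = tt
  injExtB-complete {suc M} V ρ σ σ-inj avoids extends =
    ∧⁺ (¬T⇒T-not (avoids Fin.zero))
       (∧⁺ fits-head
           (injExtB-complete _ (ρ ∘ Fin.suc) (σ ∘ Fin.suc)
              (λ i j σi≡σj → Data.Fin.Properties.suc-injective (σ-inj _ _ σi≡σj))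
              avoids-tail
              (extends ∘ Fin.suc)))
    where
    fits-head : T (fits (ρ Fin.zero) (σ Fin.zero))
    fits-head with ρ Fin.zero in ρ0
    ... | nothing = tt
    ... | just b  = ≡⇒== (extends Fin.zero b ρ0)
    avoids-tail : ∀ i → ¬ T (V (σ (Fin.suc i)) ∨ (σ (Fin.suc i) == σ Fin.zero))
    avoids-tail i t with ∨⁻ {V (σ (Fin.suc i))} t
    ... | inj₁ Vσi   = avoids (Fin.suc i) Vσi
    ... | inj₂ σi==σ0 = Data.Fin.Properties.0≢1+n (σ-inj _ _ (sym (==⇒≡ σi==σ0)))

module _ {N : ℕ} where

  private
    ∸-suc-swap : ∀ v i → N ∸ suc v ∸ i ≡ N ∸ v ∸ suc i
    ∸-suc-swap v i = begin
      N ∸ suc v ∸ i   ≡⟨ ℕP.∸-+-assoc N (suc v) i ⟩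
      N ∸ suc (v ℕ.+ i) ≡⟨ cong (N ∸_) (sym (ℕP.+-suc v i)) ⟩
      N ∸ (v ℕ.+ suc i) ≡⟨ ℕP.∸-+-assoc N v (suc i) ⟨
      N ∸ v ∸ suc i   ∎
      where open ≡-Reasoning

    ∸-pred : ∀ v i → N ∸ v ∸ i ∸ 1 ≡ N ∸ suc v ∸ i
    ∸-pred v i = begin
      N ∸ v ∸ i ∸ 1       ≡⟨ ℕP.∸-+-assoc (N ∸ v) i 1 ⟩
      N ∸ v ∸ (i ℕ.+ 1)   ≡⟨ cong (N ∸ v ∸_) (ℕP.+-comm i 1) ⟩
      N ∸ v ∸ suc i       ≡⟨ ∸-suc-swap v i ⟨
      N ∸ suc v ∸ i       ∎
      where open ≡-Reasoning

  PartialInjection : ∀ {M} → (Fin M → Maybe (Fin N)) → Set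
  PartialInjection ρ = ∀ i j b → ρ i ≡ just b → ρ j ≡ just b → i ≡ j

  Avoids : ∀ {M} → (Fin N → Bool) → (Fin M → Maybe (Fin N)) → Set
  Avoids V ρ = ∀ i b → ρ i ≡ just b → V b ≡ false

  InjExtCount : ℕ → Set
  InjExtCount M = ∀ V (ρ : Fin M → Maybe (Fin N)) → PartialInjection ρ → Avoids V ρ →
    ∑Fun M N (𝟙 ∘ injExtB V ρ) ≡ ℕ→ℚ (falling (N ∸ count N V ∸ count N (image ρ)) (M ∸ domSize ρ))

  -- The first value is either prescribed by ρ, or one of the N ∸ |V| ∸ |image ρ| free values.
  module InjExtCountStep {M} (IH : InjExtCount M) (V : Fin N → Bool) (ρ : Fin (suc M) → Maybe (Fin N))
                         (ρ-inj : PartialInjection ρ) (ρ-avoids : Avoids V ρ) where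

    ρ′ : Fin M → Maybe (Fin N)
    ρ′ = ρ ∘ Fin.suc

    v i′ d′ : ℕ
    v  = count N V
    i′ = count N (image ρ′)
    d′ = domSize ρ′

    Target : ℚ
    Target = ℕ→ℚ (falling (N ∸ v ∸ count N (image ρ)) (suc M ∸ domSize ρ))

    Rest : Fin N → ℚ
    Rest x = ∑Fun M N (𝟙 ∘ injExtB (λ y → V y ∨ (y == x)) ρ′)

    ∑Fun-by-head : ∑Fun (suc M) N (𝟙 ∘ injExtB V ρ) ≡ ∑ (allFin N) (λ x → 𝟙 (not (V x) ∧ fits (ρ Fin.zero) x) * Rest x)
    ∑Fun-by-head = trans (∑Fun-suc M N _ (cong 𝟙 ∘ injExtB-cong V ρ)) (∑-cong (allFin N) split)
      where
      split : ∀ x → ∑Fun M N (λ σ → 𝟙 (injExtB V ρ (x Vec.∷ σ))) ≡ 𝟙 (not (V x) ∧ fits (ρ Fin.zero) x) * Rest x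
      split x = trans
        (∑Fun-cong (λ σ → trans (cong 𝟙 (sym (BoolP.∧-assoc (not (V x)) (fits (ρ Fin.zero) x) (tail σ))))
                                (𝟙-∧ (not (V x) ∧ fits (ρ Fin.zero) x) (tail σ))))
        (sym (∑-*ˡ (allFuns M N) (𝟙 (not (V x) ∧ fits (ρ Fin.zero) x)) (𝟙 ∘ tail)))
        where
        tail : (Fin M → Fin N) → Bool
        tail = injExtB (λ y → V y ∨ (y == x)) ρ′

    Rest-fresh : ∀ x → V x ≡ false → image ρ′ x ≡ false → Rest x ≡ ℕ→ℚ (falling (N ∸ suc v ∸ i′) (M ∸ d′))
    Rest-fresh x Vx x∉ρ′ = trans (IH _ ρ′ ρ′-inj ρ′-avoids)
      (cong (λ u → ℕ→ℚ (falling (N ∸ u ∸ i′) (M ∸ d′))) (count-insert N V x Vx))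
      where
      ρ′-inj : PartialInjection ρ′
      ρ′-inj i j b ρi ρj = Data.Fin.Properties.suc-injective (ρ-inj _ _ b ρi ρj)
      ρ′-avoids : Avoids (λ y → V y ∨ (y == x)) ρ′
      ρ′-avoids i b ρi≡b = cong₂ _∨_ (ρ-avoids (Fin.suc i) b ρi≡b)
        (==-≢ (λ b≡x → subst T x∉ρ′ (∃⇒image ρ′ x i (trans ρi≡b (cong just b≡x)))))

    -- A value in the image of ρ′ cannot be used now: the rest of σ must take it later.
    Rest-taken : ∀ x → T (image ρ′ x) → Rest x ≡ 0ℚ
    Rest-taken x x∈ρ′ = ∑-zero (allFuns M N) (λ σ → 𝟙-false (λ t →
      let i , ρi≡x = image⇒∃ ρ′ x x∈ρ′
      in injExtB-avoids _ ρ′ σ t i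
           (subst (λ z → T (V z ∨ (z == x))) (sym (injExtB-extends _ ρ′ σ t i x ρi≡x)) (∨⁺ʳ {V x} (≡⇒== refl)))))

    prescribed : ∀ b → ρ Fin.zero ≡ just b →
                 ∑ (allFin N) (λ x → 𝟙 (not (V x) ∧ fits (ρ Fin.zero) x) * Rest x) ≡ Target
    prescribed b ρ0 = begin
      ∑ (allFin N) (λ x → 𝟙 (not (V x) ∧ fits (ρ Fin.zero) x) * Rest x)
        ≡⟨ ∑-cong (allFin N) (λ x → trans (cong (λ c → 𝟙 (not (V x) ∧ fits c x) * Rest x) ρ0) (reorder x)) ⟩
      ∑ (allFin N) (λ x → 𝟙 (x == b) * (𝟙 (not (V x)) * Rest x))
        ≡⟨ ∑-delta N b _ ⟩
      𝟙 (not (V b)) * Rest b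
        ≡⟨ trans (cong (λ u → 𝟙 (not u) * Rest b) Vb) (ℚP.*-identityˡ (Rest b)) ⟩
      Rest b
        ≡⟨ Rest-fresh b Vb b∉ρ′ ⟩
      ℕ→ℚ (falling (N ∸ suc v ∸ i′) (M ∸ d′))
        ≡⟨ cong (λ u → ℕ→ℚ (falling u (M ∸ d′))) (∸-suc-swap v i′) ⟩
      ℕ→ℚ (falling (N ∸ v ∸ suc i′) (M ∸ d′))
        ≡⟨ cong₂ (λ u c → ℕ→ℚ (falling (N ∸ v ∸ u) (suc M ∸ (𝟙ℕ (is-just c) ℕ.+ d′)))) (sym image-size) (sym ρ0) ⟩
      Target ∎
      where
      open ≡-Reasoning
      Vb : V b ≡ false
      Vb = ρ-avoids Fin.zero b ρ0
      reorder : ∀ x → 𝟙 (not (V x) ∧ (x == b)) * Rest x ≡ 𝟙 (x == b) * (𝟙 (not (V x)) * Rest x)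
      reorder x = trans (cong (_* Rest x) (trans (𝟙-∧ (not (V x)) (x == b)) (ℚP.*-comm (𝟙 (not (V x))) (𝟙 (x == b)))))
                        (ℚP.*-assoc (𝟙 (x == b)) (𝟙 (not (V x))) (Rest x))
      b∉ρ′ : image ρ′ b ≡ false
      b∉ρ′ with image ρ′ b in b∈?
      ... | false = refl
      ... | true  = let i , ρi≡b = image⇒∃ ρ′ b (subst T (sym b∈?) tt)
                    in ⊥-elim (Data.Fin.Properties.0≢1+n (ρ-inj Fin.zero (Fin.suc i) b ρ0 ρi≡b))
      image-size : count N (image ρ) ≡ suc i′
      image-size = trans (count-cong N (λ y → cong (λ c → hits c y ∨ image ρ′ y) ρ0))
                         (trans (count-∨-== N true b (image ρ′)) (cong (λ u → 𝟙ℕ (not u) ℕ.+ i′) b∉ρ′))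

    #free : count N (λ x → not (V x) ∧ not (image ρ′ x)) ≡ N ∸ v ∸ i′
    #free = begin
      count N (λ x → not (V x) ∧ not (image ρ′ x))
        ≡⟨ ℕP.m+n∸n≡m _ (v ℕ.+ i′) ⟨
      count N (λ x → not (V x) ∧ not (image ρ′ x)) ℕ.+ (v ℕ.+ i′) ∸ (v ℕ.+ i′)
        ≡⟨ cong (_∸ (v ℕ.+ i′)) (count-complement N V (image ρ′) disjoint) ⟩
      N ∸ (v ℕ.+ i′)
        ≡⟨ ℕP.∸-+-assoc N v i′ ⟨
      N ∸ v ∸ i′ ∎
      where
      open ≡-Reasoning
      disjoint : ∀ y → T (V y) → T (image ρ′ y) → ⊥
      disjoint y Vy y∈ρ′ = let i , ρi≡y = image⇒∃ ρ′ y y∈ρ′ in subst T (ρ-avoids (Fin.suc i) y ρi≡y) Vy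

    free : ρ Fin.zero ≡ nothing →
           ∑ (allFin N) (λ x → 𝟙 (not (V x) ∧ fits (ρ Fin.zero) x) * Rest x) ≡ Target
    free ρ0 = begin
      ∑ (allFin N) (λ x → 𝟙 (not (V x) ∧ fits (ρ Fin.zero) x) * Rest x)
        ≡⟨ ∑-cong (allFin N) free-value ⟩
      ∑ (allFin N) (λ x → 𝟙 (not (V x) ∧ not (image ρ′ x)) * K)
        ≡⟨ ∑-*ʳ (allFin N) K _ ⟨
      ∑ (allFin N) (λ x → 𝟙 (not (V x) ∧ not (image ρ′ x))) * K
        ≡⟨ cong (_* K) (trans (∑-allFin N _) (trans (sumFin-𝟙 N _) (cong ℕ→ℚ #free))) ⟩
      ℕ→ℚ (N ∸ v ∸ i′) * K
        ≡⟨ ×1-homo-* (N ∸ v ∸ i′) _ ⟨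
      ℕ→ℚ ((N ∸ v ∸ i′) ℕ.* falling (N ∸ suc v ∸ i′) (M ∸ d′))
        ≡⟨ cong (λ u → ℕ→ℚ ((N ∸ v ∸ i′) ℕ.* falling u (M ∸ d′))) (∸-pred v i′) ⟨
      ℕ→ℚ (falling (N ∸ v ∸ i′) (suc (M ∸ d′)))
        ≡⟨ cong (λ u → ℕ→ℚ (falling (N ∸ v ∸ i′) u)) (ℕP.+-∸-assoc 1 (count-≤ M (is-just ∘ ρ′))) ⟨
      ℕ→ℚ (falling (N ∸ v ∸ i′) (suc M ∸ d′))
        ≡⟨ cong (λ c → ℕ→ℚ (falling (N ∸ v ∸ count N (λ y → hits c y ∨ image ρ′ y))
                                    (suc M ∸ (𝟙ℕ (is-just c) ℕ.+ d′)))) (sym ρ0) ⟩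
      Target ∎
      where
      open ≡-Reasoning
      K : ℚ
      K = ℕ→ℚ (falling (N ∸ suc v ∸ i′) (M ∸ d′))
      free-value : ∀ x → 𝟙 (not (V x) ∧ fits (ρ Fin.zero) x) * Rest x ≡ 𝟙 (not (V x) ∧ not (image ρ′ x)) * K
      free-value x rewrite ρ0 with V x in Vx | image ρ′ x in x∈?
      ... | true  | _     = trans (ℚP.*-zeroˡ (Rest x)) (sym (ℚP.*-zeroˡ K))
      ... | false | true  = trans (ℚP.*-identityˡ (Rest x)) (trans (Rest-taken x (subst T (sym x∈?) tt)) (sym (ℚP.*-zeroˡ K)))
      ... | false | false = trans (ℚP.*-identityˡ (Rest x)) (trans (Rest-fresh x Vx x∈?) (sym (ℚP.*-identityˡ K)))

    count-step : ∑Fun (suc M) N (𝟙 ∘ injExtB V ρ) ≡ Target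
    count-step = trans ∑Fun-by-head (by-head (ρ Fin.zero) refl)
      where
      by-head : ∀ c → ρ Fin.zero ≡ c → ∑ (allFin N) (λ x → 𝟙 (not (V x) ∧ fits (ρ Fin.zero) x) * Rest x) ≡ Target
      by-head (just b) ρ0 = prescribed b ρ0
      by-head nothing  ρ0 = free ρ0

  ∑Fun-InjExt : ∀ M → InjExtCount M
  ∑Fun-InjExt zero    V ρ ρ-inj ρ-avoids = refl
  ∑Fun-InjExt (suc M) V ρ ρ-inj ρ-avoids = InjExtCountStep.count-step (∑Fun-InjExt M) V ρ ρ-inj ρ-avoids

anyᶠ : ∀ n → (Fin n → Bool) → Bool
anyᶠ zero    P = false
anyᶠ (suc n) P = P Fin.zero ∨ anyᶠ n (P ∘ Fin.suc)

allᶠ : ∀ n → (Fin n → Bool) → Bool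
allᶠ zero    P = true
allᶠ (suc n) P = P Fin.zero ∧ allᶠ n (P ∘ Fin.suc)

anyᶠ⇒∃ : ∀ n (P : Fin n → Bool) → T (anyᶠ n P) → ∃ λ i → T (P i)
anyᶠ⇒∃ (suc n) P t with ∨⁻ {P Fin.zero} t
... | inj₁ P0 = Fin.zero , P0
... | inj₂ t′ = let i , Pi = anyᶠ⇒∃ n (P ∘ Fin.suc) t′ in Fin.suc i , Pi

∃⇒anyᶠ : ∀ n (P : Fin n → Bool) i → T (P i) → T (anyᶠ n P)
∃⇒anyᶠ (suc n) P Fin.zero    Pi = ∨⁺ˡ Pi
∃⇒anyᶠ (suc n) P (Fin.suc i) Pi = ∨⁺ʳ {P Fin.zero} (∃⇒anyᶠ n (P ∘ Fin.suc) i Pi)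

anyᶠ-cong : ∀ n {P Q : Fin n → Bool} → P ≗ Q → anyᶠ n P ≡ anyᶠ n Q
anyᶠ-cong zero    P≗Q = refl
anyᶠ-cong (suc n) P≗Q = cong₂ _∨_ (P≗Q Fin.zero) (anyᶠ-cong n (P≗Q ∘ Fin.suc))

allᶠ⇒∀ : ∀ n (P : Fin n → Bool) → T (allᶠ n P) → ∀ i → T (P i)
allᶠ⇒∀ (suc n) P t Fin.zero    = proj₁ (∧⁻ t)
allᶠ⇒∀ (suc n) P t (Fin.suc i) = allᶠ⇒∀ n (P ∘ Fin.suc) (proj₂ (∧⁻ {P Fin.zero} t)) i

∀⇒allᶠ : ∀ n (P : Fin n → Bool) → (∀ i → T (P i)) → T (allᶠ n P)
∀⇒allᶠ zero    P ∀P = tt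
∀⇒allᶠ (suc n) P ∀P = ∧⁺ (∀P Fin.zero) (∀⇒allᶠ n (P ∘ Fin.suc) (∀P ∘ Fin.suc))

allᶠ-cong : ∀ n {P Q : Fin n → Bool} → P ≗ Q → allᶠ n P ≡ allᶠ n Q
allᶠ-cong zero    P≗Q = refl
allᶠ-cong (suc n) P≗Q = cong₂ _∧_ (P≗Q Fin.zero) (allᶠ-cong n (P≗Q ∘ Fin.suc))

anyB-tabulate : ∀ {A : Set} n (h : Fin n → A) (P : A → Bool) → anyB P (tabulate h) ≡ anyᶠ n (P ∘ h)
anyB-tabulate zero    h P = refl
anyB-tabulate (suc n) h P = cong (P (h Fin.zero) ∨_) (anyB-tabulate n (h ∘ Fin.suc) P)

allB-tabulate : ∀ {A : Set} n (h : Fin n → A) (P : A → Bool) → allB P (tabulate h) ≡ allᶠ n (P ∘ h)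
allB-tabulate zero    h P = refl
allB-tabulate (suc n) h P = cong (P (h Fin.zero) ∧_) (allB-tabulate n (h ∘ Fin.suc) P)

allB-cong : ∀ {A : Set} {P Q : A → Bool} → P ≗ Q → ∀ xs → allB P xs ≡ allB Q xs
allB-cong P≗Q []       = refl
allB-cong P≗Q (x ∷ xs) = cong₂ _∧_ (P≗Q x) (allB-cong P≗Q xs)

anyB-filter : ∀ {A : Set} {p} {R : Pred A p} (R? : Decidable R) (Q : A → Bool) xs →
              anyB Q (filter R? xs) ≡ anyB (λ x → does (R? x) ∧ Q x) xs
anyB-filter R? Q []       = refl
anyB-filter R? Q (x ∷ xs) with does (R? x)
... | true  = cong (Q x ∨_) (anyB-filter R? Q xs)
... | false = anyB-filter R? Q xs

length-filter-tabulate : ∀ {A : Set} {p} {R : Pred A p} (R? : Decidable R) n (h : Fin n → A) →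
                         length (filter R? (tabulate h)) ≡ count n (λ i → does (R? (h i)))
length-filter-tabulate R? zero    h = refl
length-filter-tabulate R? (suc n) h with does (R? (h Fin.zero))
... | true  = cong suc (length-filter-tabulate R? n (h ∘ Fin.suc))
... | false = length-filter-tabulate R? n (h ∘ Fin.suc)

does-T? : ∀ b → does (T? b) ≡ b
does-T? true  = refl
does-T? false = refl

allB-allFin⇒∀ : ∀ {k} (P : Fin k → Bool) → T (allB P (allFin k)) → ∀ i → T (P i)
allB-allFin⇒∀ {k} P t = allᶠ⇒∀ k P (subst T (allB-tabulate k (λ i → i) P) t)

∀⇒allB-allFin : ∀ {k} (P : Fin k → Bool) → (∀ i → T (P i)) → T (allB P (allFin k))
∀⇒allB-allFin {k} P ∀P = subst T (sym (allB-tabulate k (λ i → i) P)) (∀⇒allᶠ k P ∀P)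

isInjective⇒injective : ∀ {m} (σ : Fin m → Fin m) → T (isInjective σ) → ∀ a b → σ a ≡ σ b → a ≡ b
isInjective⇒injective σ t a b σa≡σb with ∨⁻ (allB-allFin⇒∀ _ (allB-allFin⇒∀ _ t a) b)
... | inj₁ σa≠σb = ⊥-elim (T-not⇒¬T σa≠σb (≡⇒== σa≡σb))
... | inj₂ a==b  = ==⇒≡ a==b

injective⇒isInjective : ∀ {m} (σ : Fin m → Fin m) → (∀ a b → σ a ≡ σ b → a ≡ b) → T (isInjective σ)
injective⇒isInjective σ σ-inj = ∀⇒allB-allFin _ (λ a → ∀⇒allB-allFin _ (λ b → decide a b))
  where
  decide : ∀ a b → T (not (σ a == σ b) ∨ (a == b))
  decide a b with σ a ≟ σ b
  ... | yes σa≡σb = ≡⇒== (σ-inj a b σa≡σb)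
  ... | no  _     = tt

Coarsens : ∀ {k p q} → (Fin k → Fin p) → (Fin k → Fin q) → Set
Coarsens f s = ∀ a b → s a ≡ s b → f a ≡ f b

coarseningB⇒Coarsens : ∀ {k} (f s : Fin k → Fin (suc k)) → T (coarseningB f s) → Coarsens f s
coarseningB⇒Coarsens f s t a b sa≡sb with ∨⁻ (allB-allFin⇒∀ _ (allB-allFin⇒∀ _ t a) b)
... | inj₁ sa≠sb = ⊥-elim (T-not⇒¬T sa≠sb (≡⇒== sa≡sb))
... | inj₂ fa==fb = ==⇒≡ fa==fb

Coarsens⇒coarseningB : ∀ {k} (f s : Fin k → Fin (suc k)) → Coarsens f s → T (coarseningB f s)
Coarsens⇒coarseningB f s f≽s = ∀⇒allB-allFin _ (λ a → ∀⇒allB-allFin _ (λ b → decide a b))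
  where
  decide : ∀ a b → T (not (s a == s b) ∨ (f a == f b))
  decide a b with s a ≟ s b
  ... | yes sa≡sb = ≡⇒== (f≽s a b sa≡sb)
  ... | no  _     = tt

SameKernel : ∀ {k p q} → (Fin k → Fin p) → (Fin k → Fin q) → Set
SameKernel h h′ = ∀ a b → (h a ≡ h b → h′ a ≡ h′ b) × (h′ a ≡ h′ b → h a ≡ h b)

module _ {k : ℕ} where

  SameKernel-sym : ∀ {p q} {h : Fin k → Fin p} {h′ : Fin k → Fin q} → SameKernel h h′ → SameKernel h′ h
  SameKernel-sym K a b = proj₂ (K a b) , proj₁ (K a b)

  SameKernel-trans : ∀ {p q r} {h : Fin k → Fin p} {h′ : Fin k → Fin q} {h″ : Fin k → Fin r} →
                     SameKernel h h′ → SameKernel h′ h″ → SameKernel h h″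
  SameKernel-trans K K′ a b = proj₁ (K′ a b) ∘ proj₁ (K a b) , proj₂ (K a b) ∘ proj₂ (K′ a b)

  ≗⇒SameKernel : ∀ {p} {h h′ : Fin k → Fin p} → h ≗ h′ → SameKernel h h′
  ≗⇒SameKernel h≗h′ a b = (λ q → trans (sym (h≗h′ a)) (trans q (h≗h′ b)))
                        , (λ q → trans (h≗h′ a) (trans q (sym (h≗h′ b))))

  SameKernel-∘-injective : ∀ {p q} (g : Fin k → Fin p) (σ : Fin p → Fin q) → (∀ a b → σ a ≡ σ b → a ≡ b) →
                           SameKernel g (σ ∘ g)
  SameKernel-∘-injective g σ σ-inj a b = cong σ , σ-inj (g a) (g b)

  ==-SameKernel : ∀ {p q} {h : Fin k → Fin p} {h′ : Fin k → Fin q} → SameKernel h h′ →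
                  ∀ a b → (h a == h b) ≡ (h′ a == h′ b)
  ==-SameKernel K a b = T-ext (≡⇒== ∘ proj₁ (K a b) ∘ ==⇒≡) (≡⇒== ∘ proj₂ (K a b) ∘ ==⇒≡)

  coarseningB-SameKernel : (g f s : Fin k → Fin (suc k)) → SameKernel g f → coarseningB g s ≡ coarseningB f s
  coarseningB-SameKernel g f s K =
    allB-cong (λ a → allB-cong (λ b → cong (not (s a == s b) ∨_) (==-SameKernel K a b)) (allFin k)) (allFin k)

#valuesOn : ∀ {k N} → (Fin k → Fin N) → (Fin k → Bool) → ℕ
#valuesOn {k} {N} h S = count N (λ a → anyᶠ k (λ m → S m ∧ (h m == a)))

#valuesOn-head : ∀ {k N} (h : Fin (suc k) → Fin N) S →
  #valuesOn h S ≡ 𝟙ℕ (S Fin.zero ∧ not (anyᶠ k (λ m → S (Fin.suc m) ∧ (h (Fin.suc m) == h Fin.zero))))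
                   ℕ.+ #valuesOn (h ∘ Fin.suc) (S ∘ Fin.suc)
#valuesOn-head {N = N} h S = count-∨-== N (S Fin.zero) (h Fin.zero) _

module _ {N : ℕ} where

  #valuesOn-SameKernel : ∀ {k N′} (h : Fin k → Fin N) (h′ : Fin k → Fin N′) → SameKernel h h′ →
                         ∀ S → #valuesOn h S ≡ #valuesOn h′ S
  #valuesOn-SameKernel {zero}  {N′} h h′ K S = trans (count-false N) (sym (count-false N′))
  #valuesOn-SameKernel {suc k}      h h′ K S = begin
    #valuesOn h S
      ≡⟨ #valuesOn-head h S ⟩
    𝟙ℕ (S Fin.zero ∧ not (anyᶠ k (λ m → S (Fin.suc m) ∧ (h (Fin.suc m) == h Fin.zero))))
      ℕ.+ #valuesOn (h ∘ Fin.suc) (S ∘ Fin.suc)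
      ≡⟨ cong₂ (λ x y → 𝟙ℕ (S Fin.zero ∧ not x) ℕ.+ y)
               (anyᶠ-cong k (λ m → cong (S (Fin.suc m) ∧_) (==-SameKernel K (Fin.suc m) Fin.zero)))
               (#valuesOn-SameKernel (h ∘ Fin.suc) (h′ ∘ Fin.suc) (λ a b → K (Fin.suc a) (Fin.suc b)) (S ∘ Fin.suc)) ⟩
    𝟙ℕ (S Fin.zero ∧ not (anyᶠ k (λ m → S (Fin.suc m) ∧ (h′ (Fin.suc m) == h′ Fin.zero))))
      ℕ.+ #valuesOn (h′ ∘ Fin.suc) (S ∘ Fin.suc)
      ≡⟨ #valuesOn-head h′ S ⟨
    #valuesOn h′ S ∎
    where open ≡-Reasoning

  #valuesOn-agree : ∀ {k} (h h′ : Fin k → Fin N) S → (∀ m → T (S m) → h m ≡ h′ m) →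
                    #valuesOn h S ≡ #valuesOn h′ S
  #valuesOn-agree {k} h h′ S agree = count-cong N (λ a → anyᶠ-cong k (λ m → on m (S m) refl))
    where
    on : ∀ {a} m b → S m ≡ b → (b ∧ (h m == a)) ≡ (b ∧ (h′ m == a))
    on m false _   = refl
    on m true  Sm  = cong (λ z → z == _) (agree m (subst T (sym Sm) tt))

  #valuesOn-cong : ∀ {k} (h : Fin k → Fin N) {S S′} → S ≗ S′ → #valuesOn h S ≡ #valuesOn h S′
  #valuesOn-cong {k} h S≗S′ = count-cong N (λ a → anyᶠ-cong k (λ m → cong (_∧ (h m == a)) (S≗S′ m)))

  #valuesOn-insert : ∀ {k} (h : Fin k → Fin N) S x →
    #valuesOn h (λ m → S m ∨ (m == x)) ≡ 𝟙ℕ (not (anyᶠ k (λ m → S m ∧ (h m == h x)))) ℕ.+ #valuesOn h S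
  #valuesOn-insert {k} h S x =
    trans (count-cong N (λ a → T-ext (split a) (merge a)))
          (count-∨-== N true (h x) (λ a → anyᶠ k (λ m → S m ∧ (h m == a))))
    where
    split : ∀ a → T (anyᶠ k (λ m → (S m ∨ (m == x)) ∧ (h m == a))) →
            T ((h x == a) ∨ anyᶠ k (λ m → S m ∧ (h m == a)))
    split a t with anyᶠ⇒∃ k _ t
    ... | m , p with ∧⁻ {S m ∨ (m == x)} p
    ... | Sm∨m==x , hm==a with ∨⁻ {S m} Sm∨m==x
    ... | inj₁ Sm   = ∨⁺ʳ {h x == a} (∃⇒anyᶠ k _ m (∧⁺ Sm hm==a))
    ... | inj₂ m==x = ∨⁺ˡ (subst (λ z → T (h z == a)) (==⇒≡ m==x) hm==a)
    merge : ∀ a → T ((h x == a) ∨ anyᶠ k (λ m → S m ∧ (h m == a))) →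
            T (anyᶠ k (λ m → (S m ∨ (m == x)) ∧ (h m == a)))
    merge a t with ∨⁻ {h x == a} t
    ... | inj₁ hx==a = ∃⇒anyᶠ k _ x (∧⁺ (∨⁺ʳ {S x} (≡⇒== refl)) hx==a)
    ... | inj₂ t′    = let m , p = anyᶠ⇒∃ k _ t′ ; Sm , hm==a = ∧⁻ {S m} p
                       in ∃⇒anyᶠ k _ m (∧⁺ (∨⁺ˡ {S m} Sm) hm==a)

  #valuesOn-mono : ∀ {k} (h : Fin k → Fin N) S S′ → (∀ m → T (S m) → T (S′ m)) → #valuesOn h S ≤ #valuesOn h S′
  #valuesOn-mono {k} h S S′ S⊆S′ = count-mono N _ _ (λ a t →
    let m , p = anyᶠ⇒∃ k _ t ; Sm , hm==a = ∧⁻ {S m} p in ∃⇒anyᶠ k _ m (∧⁺ (S⊆S′ m Sm) hm==a))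

cardSP≡#valuesOn : ∀ {k N} (h : Fin k → Fin N) → cardSP h ≡ #valuesOn h (λ _ → true)
cardSP≡#valuesOn {k} {N} h = trans (length-filter-tabulate _ N (λ i → i))
  (count-cong N (λ a → trans (does-T? _) (anyB-tabulate k (λ i → i) _)))

cardSP-SameKernel : ∀ {k N N′} (h : Fin k → Fin N) (h′ : Fin k → Fin N′) → SameKernel h h′ → cardSP h ≡ cardSP h′
cardSP-SameKernel h h′ K = trans (cardSP≡#valuesOn h) (trans (#valuesOn-SameKernel h h′ K _) (sym (cardSP≡#valuesOn h′)))

-- Restricted-growth labelings

before : ∀ {k} → ℕ → Fin k → Bool
before t m = does (toℕ m ℕ.<? t)

before⇒< : ∀ {k t} {m : Fin k} → T (before t m) → toℕ m < t
before⇒< {t = t} {m} = ℕP.<ᵇ⇒< (toℕ m) t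

<⇒before : ∀ {k t} {m : Fin k} → toℕ m < t → T (before t m)
<⇒before = ℕP.<⇒<ᵇ

module _ {k N : ℕ} where

  seenBefore : (Fin k → Fin N) → ℕ → Fin N → Bool
  seenBefore h t a = anyᶠ k (λ m → before t m ∧ (h m == a))

  #valuesBefore : (Fin k → Fin N) → ℕ → ℕ
  #valuesBefore h t = #valuesOn h (before t)

  Canonical : (Fin k → Fin N) → Set
  Canonical h = ∀ l → T (seenBefore h (toℕ l) (h l)) ⊎ toℕ (h l) ≡ #valuesBefore h (toℕ l)

  Canonical-cong : ∀ {h h′} → h ≗ h′ → Canonical h → Canonical h′
  Canonical-cong {h} {h′} h≗h′ canon l with canon l
  ... | inj₁ seen = inj₁ (subst T (anyᶠ-cong k (λ m → cong₂ (λ x y → before (toℕ l) m ∧ (x == y)) (h≗h′ m) (h≗h′ l))) seen)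
  ... | inj₂ new  = inj₂ (trans (cong toℕ (sym (h≗h′ l))) (trans new (#valuesOn-agree h h′ _ (λ m _ → h≗h′ m))))

module _ {k : ℕ} where

  private
    canonicalAt : (Fin k → Fin (suc k)) → Fin k → Bool
    canonicalAt g l = seenBefore g (toℕ l) (g l) ∨ ⌊ toℕ (g l) ℕ.≟ #valuesBefore g (toℕ l) ⌋

    earlier : Fin k → List (Fin k)
    earlier l = filter (λ m → toℕ m ℕ.<? toℕ l) (allFin k)

    anyB-earlier : ∀ (g : Fin k → Fin (suc k)) l a → anyB (λ m → g m == a) (earlier l) ≡ seenBefore g (toℕ l) a
    anyB-earlier g l a = trans (anyB-filter (λ m → toℕ m ℕ.<? toℕ l) (λ m → g m == a) (allFin k))
                               (anyB-tabulate k (λ i → i) _)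

    canonicalB≡allᶠ : (g : Fin k → Fin (suc k)) → canonicalB g ≡ allᶠ k (canonicalAt g)
    canonicalB≡allᶠ g = trans (allB-tabulate k (λ i → i) _) (allᶠ-cong k (λ l → cong₂ _∨_
      (anyB-earlier g l (g l))
      (cong (λ c → ⌊ toℕ (g l) ℕ.≟ c ⌋)
        (trans (length-filter-tabulate (λ a → T? (anyB (λ m → g m == a) (earlier l))) (suc k) (λ i → i))
               (count-cong (suc k) (λ a → trans (does-T? _) (anyB-earlier g l a)))))))

  canonicalB⇒Canonical : (g : Fin k → Fin (suc k)) → T (canonicalB g) → Canonical g
  canonicalB⇒Canonical g t l with ∨⁻ {seenBefore g (toℕ l) (g l)} (allᶠ⇒∀ k _ (subst T (canonicalB≡allᶠ g) t) l)
  ... | inj₁ seen = inj₁ seen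
  ... | inj₂ new  = inj₂ (toWitness new)

  Canonical⇒canonicalB : (g : Fin k → Fin (suc k)) → Canonical g → T (canonicalB g)
  Canonical⇒canonicalB g canon = subst T (sym (canonicalB≡allᶠ g)) (∀⇒allᶠ k _ at)
    where
    at : ∀ l → T (canonicalAt g l)
    at l with canon l
    ... | inj₁ seen = ∨⁺ˡ seen
    ... | inj₂ new  = ∨⁺ʳ {seenBefore g (toℕ l) (g l)} (fromWitness new)

-- Number the values of h in order of first occurrence.
module CanonicalForm {k N : ℕ} (h : Fin k → Fin N) where

  private
    firstOccurrence : ∀ l → ∃ λ i → ¬ (h i ≢ h l) × ((j : Fin.Fin′ i) → h (Fin.inject j) ≢ h l)
    firstOccurrence l = Data.Fin.Properties.¬∀⟶∃¬-smallest k (λ m → h m ≢ h l)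
                          (λ m → ¬? (h m ≟ h l)) (λ all≢ → all≢ l refl)

  first : Fin k → Fin k
  first l = proj₁ (firstOccurrence l)

  first-eq : ∀ l → h (first l) ≡ h l
  first-eq l = decidable-stable (h (first l) ≟ h l) (proj₁ (proj₂ (firstOccurrence l)))

  first-min : ∀ l m → h m ≡ h l → toℕ (first l) ≤ toℕ m
  first-min l m hm≡hl = ℕP.≮⇒≥ λ m<first →
    proj₂ (proj₂ (firstOccurrence l)) (Fin.fromℕ< m<first)
      (subst (λ z → h z ≡ h l) (sym (Data.Fin.Properties.toℕ-injective
        (trans (Data.Fin.Properties.toℕ-inject (Fin.fromℕ< m<first)) (Data.Fin.Properties.toℕ-fromℕ< m<first)))) hm≡hl)

  first-cong : ∀ a b → h a ≡ h b → first a ≡ first b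
  first-cong a b ha≡hb = Data.Fin.Properties.toℕ-injective (ℕP.≤-antisym
    (first-min a (first b) (trans (first-eq b) (sym ha≡hb)))
    (first-min b (first a) (trans (first-eq a) ha≡hb)))

  first-unseen : ∀ l → ¬ T (seenBefore h (toℕ (first l)) (h l))
  first-unseen l t with anyᶠ⇒∃ k _ t
  ... | m , p = let m<first , hm==hl = ∧⁻ {before (toℕ (first l)) m} p
                in ℕP.<⇒≱ (before⇒< {m = m} m<first) (first-min l m (==⇒≡ hm==hl))

  #valuesBefore-first<N : ∀ l → #valuesBefore h (toℕ (first l)) < N
  #valuesBefore-first<N l = count-< N _ (h l) (unseen (seenBefore h (toℕ (first l)) (h l)) refl)
    where
    unseen : ∀ b → seenBefore h (toℕ (first l)) (h l) ≡ b → b ≡ false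
    unseen false _    = refl
    unseen true  seen = ⊥-elim (first-unseen l (subst T (sym seen) tt))

  canon : Fin k → Fin N
  canon l = Fin.fromℕ< (#valuesBefore-first<N l)

  toℕ-canon : ∀ l → toℕ (canon l) ≡ #valuesBefore h (toℕ (first l))
  toℕ-canon l = Data.Fin.Properties.toℕ-fromℕ< (#valuesBefore-first<N l)

  private
    before-suc : ∀ (u : Fin k) m → before (suc (toℕ u)) m ≡ (before (toℕ u) m ∨ (m == u))
    before-suc u m = T-ext widen narrow
      where
      widen : T (before (suc (toℕ u)) m) → T (before (toℕ u) m ∨ (m == u))
      widen t with ℕP.m≤n⇒m<n∨m≡n (ℕ.s≤s⁻¹ (before⇒< {m = m} t))
      ... | inj₁ m<u = ∨⁺ˡ (<⇒before {m = m} m<u)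
      ... | inj₂ m≡u = ∨⁺ʳ {before (toℕ u) m} (≡⇒== (Data.Fin.Properties.toℕ-injective m≡u))
      narrow : T (before (toℕ u) m ∨ (m == u)) → T (before (suc (toℕ u)) m)
      narrow t with ∨⁻ {before (toℕ u) m} t
      ... | inj₁ m<u  = <⇒before {m = m} (ℕP.m≤n⇒m≤1+n (before⇒< {m = m} m<u))
      ... | inj₂ m==u = <⇒before {m = m} (s≤s (ℕP.≤-reflexive (cong toℕ (==⇒≡ m==u))))

  #valuesBefore-new : ∀ u → ¬ T (seenBefore h (toℕ u) (h u)) →
                      #valuesBefore h (suc (toℕ u)) ≡ suc (#valuesBefore h (toℕ u))
  #valuesBefore-new u unseen =
    trans (#valuesOn-cong h (before-suc u))
          (trans (#valuesOn-insert h (before (toℕ u)) u)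
                 (cong (λ b → 𝟙ℕ (not b) ℕ.+ #valuesBefore h (toℕ u)) (unseen⇒false _ refl)))
    where
    unseen⇒false : ∀ b → seenBefore h (toℕ u) (h u) ≡ b → seenBefore h (toℕ u) (h u) ≡ false
    unseen⇒false false seen = seen
    unseen⇒false true  seen = ⊥-elim (unseen (subst T (sym seen) tt))

  #valuesBefore-mono : ∀ t t′ → t ≤ t′ → #valuesBefore h t ≤ #valuesBefore h t′
  #valuesBefore-mono t t′ t≤t′ = #valuesOn-mono h _ _ (λ m p → <⇒before {m = m} (ℕP.<-≤-trans (before⇒< {m = m} p) t≤t′))

  canon-SameKernel : SameKernel canon h
  canon-SameKernel a b = reflects , preserves
    where
    preserves : h a ≡ h b → canon a ≡ canon b
    preserves ha≡hb = Data.Fin.Properties.toℕ-injective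
      (trans (toℕ-canon a) (trans (cong (λ z → #valuesBefore h (toℕ z)) (first-cong a b ha≡hb)) (sym (toℕ-canon b))))
    -- Distinct values first occur at different times, and each new value increases the count.
    canon-< : ∀ x y → toℕ (first x) < toℕ (first y) → toℕ (canon x) < toℕ (canon y)
    canon-< x y first< = subst₂ _<_ (sym (toℕ-canon x)) (sym (toℕ-canon y))
      (ℕP.<-≤-trans (ℕP.≤-reflexive (sym (#valuesBefore-new (first x)
         (subst (λ z → ¬ T (seenBefore h (toℕ (first x)) z)) (sym (first-eq x)) (first-unseen x)))))
         (#valuesBefore-mono _ _ first<))
    reflects : canon a ≡ canon b → h a ≡ h b
    reflects ca≡cb with h a ≟ h b
    ... | yes ha≡hb = ha≡hb
    ... | no  ha≢hb with ℕP.<-cmp (toℕ (first a)) (toℕ (first b))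
    ... | tri< lt _ _ = ⊥-elim (ℕP.<-irrefl (cong toℕ ca≡cb) (canon-< a b lt))
    ... | tri> _ _ gt = ⊥-elim (ℕP.<-irrefl (cong toℕ (sym ca≡cb)) (canon-< b a gt))
    ... | tri≈ _ eq _ = ⊥-elim (ha≢hb (trans (sym (first-eq a))
                                  (trans (cong h (Data.Fin.Properties.toℕ-injective eq)) (first-eq b))))

  canon-Canonical : Canonical canon
  canon-Canonical l with first l ≟ l
  ... | yes first≡l = inj₂ (trans (toℕ-canon l) (trans (cong (λ z → #valuesBefore h (toℕ z)) first≡l)
                              (#valuesOn-SameKernel h canon (SameKernel-sym canon-SameKernel) _)))
  ... | no  first≢l = inj₁ (∃⇒anyᶠ k _ (first l)
          (∧⁺ (<⇒before {m = first l} (ℕP.≤∧≢⇒< (first-min l l refl) (first≢l ∘ Data.Fin.Properties.toℕ-injective)))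
              (≡⇒== (proj₂ (canon-SameKernel (first l) l) (first-eq l)))))

Canonical-unique : ∀ {k N} (g g′ : Fin k → Fin N) → Canonical g → Canonical g′ → SameKernel g g′ → g ≗ g′
Canonical-unique {k} g g′ canon canon′ K l = agreeBelow (suc (toℕ l)) l ℕP.≤-refl
  where
  agreeBelow : ∀ b l → toℕ l < b → g l ≡ g′ l
  agreeBelow (suc b) l l<b = by (canon l) (canon′ l)
    where
    IH : ∀ m → T (before (toℕ l) m) → g m ≡ g′ m
    IH m m<l = agreeBelow b m (ℕP.<-≤-trans (before⇒< {m = m} m<l) (ℕ.s≤s⁻¹ l<b))
    by : _ → _ → g l ≡ g′ l
    by (inj₁ seen) _ with anyᶠ⇒∃ k _ seen
    ... | m , p = let m<l , gm==gl = ∧⁻ {before (toℕ l) m} p ; gm≡gl = ==⇒≡ gm==gl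
                  in trans (sym gm≡gl) (trans (IH m m<l) (proj₁ (K m l) gm≡gl))
    by (inj₂ _) (inj₁ seen′) with anyᶠ⇒∃ k _ seen′
    ... | m , p = let m<l , gm==gl = ∧⁻ {before (toℕ l) m} p ; gm≡gl = ==⇒≡ gm==gl
                  in trans (sym (proj₂ (K m l) gm≡gl)) (trans (IH m m<l) gm≡gl)
    by (inj₂ new) (inj₂ new′) = Data.Fin.Properties.toℕ-injective
      (trans new (trans (#valuesOn-agree g g′ _ IH) (sym new′)))

Canonical⇒≗canon : ∀ {k N} (g f : Fin k → Fin N) → Canonical g → SameKernel g f → g ≗ CanonicalForm.canon f
Canonical⇒≗canon g f canon K = Canonical-unique g (CanonicalForm.canon f) canon (CanonicalForm.canon-Canonical f)
  (SameKernel-trans K (SameKernel-sym (CanonicalForm.canon-SameKernel f)))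

-- Counting permutations σ with σ ∘ g = f

module PermutationsThrough {k : ℕ} (g f : Fin k → Fin (suc k)) (K : SameKernel g f) where

  private
    N : ℕ
    N = suc k

  -- σ is pinned down on the image of g; ρ records these prescribed values.
  ρ : Fin N → Maybe (Fin N)
  ρ a with Data.Fin.Properties.any? (λ l → g l ≟ a)
  ... | yes (l , _) = just (f l)
  ... | no  _       = nothing

  ρ-just : ∀ a b → ρ a ≡ just b → ∃ λ l → g l ≡ a × f l ≡ b
  ρ-just a b ρa≡b with Data.Fin.Properties.any? (λ l → g l ≟ a)
  ρ-just a b refl | yes (l , gl≡a) = l , gl≡a , refl

  ρ-image : ∀ l → ρ (g l) ≡ just (f l)
  ρ-image l with Data.Fin.Properties.any? (λ l′ → g l′ ≟ g l)
  ... | yes (l′ , gl′≡gl) = cong just (proj₁ (K l′ l) gl′≡gl)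
  ... | no  ∄l′           = ⊥-elim (∄l′ (l , refl))

  ρ-injective : ∀ a a′ b → ρ a ≡ just b → ρ a′ ≡ just b → a ≡ a′
  ρ-injective a a′ b ρa ρa′ =
    let l , gl≡a , fl≡b = ρ-just a b ρa ; l′ , gl′≡a′ , fl′≡b = ρ-just a′ b ρa′
    in trans (sym gl≡a) (trans (proj₂ (K l l′) (trans fl≡b (sym fl′≡b))) gl′≡a′)

  InjExt⇔through : ∀ σ → injExtB (λ _ → false) ρ σ ≡ (isInjective σ ∧ (f =ᶠ σ ∘ g))
  InjExt⇔through σ = T-ext to from
    where
    to : T (injExtB (λ _ → false) ρ σ) → T (isInjective σ ∧ (f =ᶠ σ ∘ g))
    to t = ∧⁺ (injective⇒isInjective σ (injExtB-injective (λ _ → false) ρ σ t))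
              (≗⇒=ᶠ (λ l → sym (injExtB-extends (λ _ → false) ρ σ t (g l) (f l) (ρ-image l))))
    from : T (isInjective σ ∧ (f =ᶠ σ ∘ g)) → T (injExtB (λ _ → false) ρ σ)
    from t = let σ-inj , f≗σ∘g = ∧⁻ {isInjective σ} t in
      injExtB-complete (λ _ → false) ρ σ (isInjective⇒injective σ σ-inj) (λ _ ())
        (λ a b ρa≡b → let l , gl≡a , fl≡b = ρ-just a b ρa≡b
                      in trans (cong σ (sym gl≡a)) (trans (sym (=ᶠ⇒≗ f≗σ∘g l)) fl≡b))

  count-image-ρ : count N (image ρ) ≡ cardSP f
  count-image-ρ = trans (count-cong N (λ b → T-ext
      (λ t → let a , ρa≡b = image⇒∃ ρ b t ; l , _ , fl≡b = ρ-just a b ρa≡b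
             in ∃⇒anyᶠ k (λ l → true ∧ (f l == b)) l (≡⇒== fl≡b))
      (λ t → let l , fl==b = anyᶠ⇒∃ k (λ l → true ∧ (f l == b)) t
             in ∃⇒image ρ b (g l) (trans (ρ-image l) (cong just (==⇒≡ fl==b))))))
    (sym (cardSP≡#valuesOn f))

  domSize-ρ : domSize ρ ≡ cardSP g
  domSize-ρ = trans (count-cong N (λ a → T-ext (defined a (ρ a) refl)
      (λ t → let l , gl==a = anyᶠ⇒∃ k (λ l → true ∧ (g l == a)) t
             in subst (T ∘ is-just ∘ ρ) (==⇒≡ gl==a) (subst (T ∘ is-just) (sym (ρ-image l)) tt))))
    (sym (cardSP≡#valuesOn g))
    where
    defined : ∀ a c → ρ a ≡ c → T (is-just c) → T (anyᶠ k (λ l → true ∧ (g l == a)))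
    defined a (just b) ρa≡b _ = let l , gl≡a , _ = ρ-just a b ρa≡b in ∃⇒anyᶠ k _ l (≡⇒== gl≡a)

  ∑-through≡factorial : ∑Fun N N (λ σ → 𝟙 (isInjective σ ∧ (f =ᶠ σ ∘ g))) ≡ ℕ→ℚ ((N ∸ cardSP g) !)
  ∑-through≡factorial = begin
    ∑Fun N N (λ σ → 𝟙 (isInjective σ ∧ (f =ᶠ σ ∘ g)))
      ≡⟨ ∑Fun-cong (λ σ → cong 𝟙 (sym (InjExt⇔through σ))) ⟩
    ∑Fun N N (𝟙 ∘ injExtB (λ _ → false) ρ)
      ≡⟨ ∑Fun-InjExt N (λ _ → false) ρ ρ-injective (λ _ _ _ → refl) ⟩
    ℕ→ℚ (falling (N ∸ count N (λ _ → false) ∸ count N (image ρ)) (N ∸ domSize ρ))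
      ≡⟨ cong₂ (λ x y → ℕ→ℚ (falling (N ∸ x ∸ y) (N ∸ domSize ρ)))
               (count-false N) (trans count-image-ρ (cardSP-SameKernel f g (SameKernel-sym K))) ⟩
    ℕ→ℚ (falling (N ∸ cardSP g) (N ∸ domSize ρ))
      ≡⟨ cong (λ y → ℕ→ℚ (falling (N ∸ cardSP g) (N ∸ y))) domSize-ρ ⟩
    ℕ→ℚ (falling (N ∸ cardSP g) (N ∸ cardSP g))
      ≡⟨ cong ℕ→ℚ (falling-n-n≡n! (N ∸ cardSP g)) ⟩
    ℕ→ℚ ((N ∸ cardSP g) !) ∎
    where open ≡-Reasoning

-- Each labeling f is σ ∘ g for its canonical form g and exactly (N ∸ cardSP g)! permutations σ

module _ {k : ℕ} where

  private
    N : ℕ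
    N = suc k

  weight : (Fin k → Fin N) → ℚ
  weight g = 1ℚ ÷ℕ ((N ∸ cardSP g) !)

  multiplicity : (g f : Fin k → Fin N) → ℚ
  multiplicity g f = ∑Fun N N (λ σ → 𝟙 (isInjective σ ∧ (f =ᶠ σ ∘ g)))

  ∑-perms-through : (G : (Fin k → Fin N) → ℚ) → Respects≗ G →
                    ∀ g → ∑ (perms N) (λ σ → G (σ ∘ g)) ≡ ∑Fun k N (λ f → multiplicity g f * G f)
  ∑-perms-through G G-resp g = begin
    ∑ (perms N) (λ σ → G (σ ∘ g))
      ≡⟨ ∑-filter (T? ∘ isInjective) (allFuns N N) _ ⟩
    ∑Fun N N (λ σ → 𝟙 (does (T? (isInjective σ))) * G (σ ∘ g))
      ≡⟨ ∑Fun-cong (λ σ → cong₂ _*_ (cong 𝟙 (does-T? (isInjective σ))) (sym (∑Fun-delta k N (σ ∘ g) G G-resp))) ⟩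
    ∑Fun N N (λ σ → 𝟙 (isInjective σ) * ∑Fun k N (λ f → 𝟙 (f =ᶠ σ ∘ g) * G f))
      ≡⟨ ∑Fun-cong (λ σ → ∑-*ˡ (allFuns k N) (𝟙 (isInjective σ)) (λ f → 𝟙 (f =ᶠ σ ∘ g) * G f)) ⟩
    ∑Fun N N (λ σ → ∑Fun k N (λ f → 𝟙 (isInjective σ) * (𝟙 (f =ᶠ σ ∘ g) * G f)))
      ≡⟨ ∑-comm (allFuns N N) (allFuns k N) _ ⟩
    ∑Fun k N (λ f → ∑Fun N N (λ σ → 𝟙 (isInjective σ) * (𝟙 (f =ᶠ σ ∘ g) * G f)))
      ≡⟨ ∑Fun-cong (λ f → trans (∑Fun-cong (λ σ →
           trans (sym (ℚP.*-assoc (𝟙 (isInjective σ)) _ (G f)))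
                 (cong (_* G f) (sym (𝟙-∧ (isInjective σ) (f =ᶠ σ ∘ g))))))
           (sym (∑-*ʳ (allFuns N N) (G f) _))) ⟩
    ∑Fun k N (λ f → multiplicity g f * G f) ∎
    where open ≡-Reasoning

module _ {k : ℕ} (s : Fin k → Fin (suc k)) where

  private
    N : ℕ
    N = suc k

  canonicalCoarsening : (Fin k → Fin N) → Bool
  canonicalCoarsening g = canonicalB g ∧ coarseningB g s

  multiplicity-weight : ∀ f g → 𝟙 (canonicalCoarsening g) * (weight g * multiplicity g f)
                              ≡ 𝟙 (g =ᶠ CanonicalForm.canon f) * 𝟙 (coarseningB f s)
  multiplicity-weight f g with g =ᶠ CanonicalForm.canon f in g=canon
  ... | true = begin
    𝟙 (canonicalB g ∧ coarseningB g s) * (weight g * multiplicity g f)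
      ≡⟨ cong₂ (λ c m → 𝟙 (c ∧ coarseningB g s) * (weight g * m)) g-canonical
               (PermutationsThrough.∑-through≡factorial g f K) ⟩
    𝟙 (coarseningB g s) * (weight g * ℕ→ℚ ((N ∸ cardSP g) !))
      ≡⟨ cong₂ (λ c w → 𝟙 c * w) (coarseningB-SameKernel g f s K) (÷ℕ-inverse _ (ℕP.1≤n! (N ∸ cardSP g))) ⟩
    𝟙 (coarseningB f s) * 1ℚ
      ≡⟨ trans (ℚP.*-identityʳ (𝟙 (coarseningB f s))) (sym (ℚP.*-identityˡ (𝟙 (coarseningB f s)))) ⟩
    1ℚ * 𝟙 (coarseningB f s) ∎
    where
    open ≡-Reasoning
    g≗canon : g ≗ CanonicalForm.canon f
    g≗canon = =ᶠ⇒≗ (subst T (sym g=canon) tt)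
    K : SameKernel g f
    K = SameKernel-trans (≗⇒SameKernel g≗canon) (CanonicalForm.canon-SameKernel f)
    g-canonical : canonicalB g ≡ true
    g-canonical = Equivalence.to BoolP.T-≡ (Canonical⇒canonicalB g
      (Canonical-cong (sym ∘ g≗canon) (CanonicalForm.canon-Canonical f)))
  ... | false with canonicalB g in g-canonical
  ...   | false = trans (ℚP.*-zeroˡ (weight g * multiplicity g f)) (sym (ℚP.*-zeroˡ (𝟙 (coarseningB f s))))
  ...   | true  = trans (cong (λ m → 𝟙 (coarseningB g s) * (weight g * m)) no-σ)
                  (trans (cong (𝟙 (coarseningB g s) *_) (ℚP.*-zeroʳ (weight g)))
                  (trans (ℚP.*-zeroʳ (𝟙 (coarseningB g s))) (sym (ℚP.*-zeroˡ (𝟙 (coarseningB f s))))))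
    where
    no-σ : multiplicity g f ≡ 0ℚ
    no-σ = ∑-zero (allFuns N N) (λ σ → 𝟙-false (λ t →
      let σ-inj , f=σ∘g = ∧⁻ {isInjective σ} t
          K : SameKernel g f
          K = SameKernel-trans (SameKernel-∘-injective g σ (isInjective⇒injective σ σ-inj))
                               (≗⇒SameKernel (sym ∘ =ᶠ⇒≗ f=σ∘g))
      in subst T g=canon (≗⇒=ᶠ (Canonical⇒≗canon g f (canonicalB⇒Canonical g (subst T (sym g-canonical) tt)) K))))

  ∑-coarsenings : (G : (Fin k → Fin N) → ℚ) → Respects≗ G →
                  ∑ (coarsenings k s) (λ g → weight g * ∑ (perms N) (λ σ → G (σ ∘ g)))
                    ≡ ∑Fun k N (λ f → 𝟙 (coarseningB f s) * G f)
  ∑-coarsenings G G-resp = begin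
    ∑ (coarsenings k s) (λ g → weight g * ∑ (perms N) (λ σ → G (σ ∘ g)))
      ≡⟨ ∑-filter (T? ∘ canonicalCoarsening) (allFuns k N) _ ⟩
    ∑Fun k N (λ g → 𝟙 (does (T? (canonicalCoarsening g))) * (weight g * ∑ (perms N) (λ σ → G (σ ∘ g))))
      ≡⟨ ∑Fun-cong expand ⟩
    ∑Fun k N (λ g → ∑Fun k N (λ f → 𝟙 (canonicalCoarsening g) * (weight g * multiplicity g f) * G f))
      ≡⟨ ∑-comm (allFuns k N) (allFuns k N) _ ⟩
    ∑Fun k N (λ f → ∑Fun k N (λ g → 𝟙 (canonicalCoarsening g) * (weight g * multiplicity g f) * G f))
      ≡⟨ ∑Fun-cong (λ f → trans (sym (∑-*ʳ (allFuns k N) (G f) _))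
                               (cong (_* G f) (trans (∑Fun-cong (multiplicity-weight f))
                                 (∑Fun-delta k N (CanonicalForm.canon f) (λ _ → 𝟙 (coarseningB f s)) (λ _ → refl))))) ⟩
    ∑Fun k N (λ f → 𝟙 (coarseningB f s) * G f) ∎
    where
    open ≡-Reasoning
    expand : ∀ g → 𝟙 (does (T? (canonicalCoarsening g))) * (weight g * ∑ (perms N) (λ σ → G (σ ∘ g)))
                 ≡ ∑Fun k N (λ f → 𝟙 (canonicalCoarsening g) * (weight g * multiplicity g f) * G f)
    expand g = begin
      𝟙 (does (T? (canonicalCoarsening g))) * (weight g * ∑ (perms N) (λ σ → G (σ ∘ g)))
        ≡⟨ cong₂ (λ c p → 𝟙 c * (weight g * p)) (does-T? (canonicalCoarsening g)) (∑-perms-through G G-resp g) ⟩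
      𝟙 (canonicalCoarsening g) * (weight g * ∑Fun k N (λ f → multiplicity g f * G f))
        ≡⟨ cong (𝟙 (canonicalCoarsening g) *_) (∑-*ˡ (allFuns k N) (weight g) _) ⟩
      𝟙 (canonicalCoarsening g) * ∑Fun k N (λ f → weight g * (multiplicity g f * G f))
        ≡⟨ ∑-*ˡ (allFuns k N) (𝟙 (canonicalCoarsening g)) _ ⟩
      ∑Fun k N (λ f → 𝟙 (canonicalCoarsening g) * (weight g * (multiplicity g f * G f)))
        ≡⟨ ∑Fun-cong (λ f → cong (𝟙 (canonicalCoarsening g) *_) (sym (ℚP.*-assoc (weight g) _ (G f)))) ⟩
      ∑Fun k N (λ f → 𝟙 (canonicalCoarsening g) * (weight g * multiplicity g f * G f))
        ≡⟨ ∑Fun-cong (λ f → sym (ℚP.*-assoc (𝟙 (canonicalCoarsening g)) _ (G f))) ⟩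
      ∑Fun k N (λ f → 𝟙 (canonicalCoarsening g) * (weight g * multiplicity g f) * G f) ∎

-- A singleton block of s leaves the label at its position free

infixl 6 _[_]≔_
_[_]≔_ : ∀ {k N} → (Fin k → Fin N) → Fin k → Fin N → (Fin k → Fin N)
f [ l ]≔ i = Vec.updateAt f l (λ _ → i)

module _ {k N : ℕ} (f : Fin k → Fin N) (l : Fin k) (i : Fin N) where

  updated : (f [ l ]≔ i) l ≡ i
  updated = VecP.updateAt-updates l f

  not-updated : ∀ m → m ≢ l → (f [ l ]≔ i) m ≡ f m
  not-updated m m≢l = VecP.updateAt-minimal m l f m≢l

module SingletonBlock {k : ℕ} (s : Fin k → Fin (suc k)) (l : Fin k) (singleton : ∀ m → s m ≡ s l → m ≡ l) where

  private
    N : ℕ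
    N = suc k

  Coarsens-off-l : ∀ {p} (f f′ : Fin k → Fin p) → (∀ m → m ≢ l → f m ≡ f′ m) → Coarsens f s → Coarsens f′ s
  Coarsens-off-l f f′ agree f≽s a b sa≡sb with a ≟ l | b ≟ l
  ... | yes a≡l | _       = cong f′ (trans a≡l (sym (singleton b (trans (sym sa≡sb) (cong s a≡l)))))
  ... | no  _   | yes b≡l = cong f′ (trans (singleton a (trans sa≡sb (cong s b≡l))) (sym b≡l))
  ... | no  a≢l | no  b≢l = trans (sym (agree a a≢l)) (trans (f≽s a b sa≡sb) (agree b b≢l))

  coarseningB-off-l : ∀ (f f′ : Fin k → Fin N) → (∀ m → m ≢ l → f m ≡ f′ m) → T (coarseningB f s) → T (coarseningB f′ s)
  coarseningB-off-l f f′ agree t =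
    Coarsens⇒coarseningB f′ s (Coarsens-off-l f f′ agree (coarseningB⇒Coarsens f s t))

  anchored : (Fin k → Fin N) → Bool
  anchored f = coarseningB f s ∧ (f l == Fin.zero)

  -- (f , i) ↦ f [ l ]≔ i is a bijection from anchored f and labels i onto coarsenings h,
  -- with inverse h ↦ (h [ l ]≔ 0 , h l).
  reassemble : ∀ h f i → 𝟙 (anchored f ∧ (h =ᶠ f [ l ]≔ i))
                       ≡ 𝟙 ((f =ᶠ h [ l ]≔ Fin.zero) ∧ ((i == h l) ∧ coarseningB h s))
  reassemble h f i = cong 𝟙 (T-ext to from)
    where
    byCases : ∀ {A : Set} m → (m ≡ l → A) → (m ≢ l → A) → A
    byCases m on off with m ≟ l
    ... | yes m≡l = on m≡l
    ... | no  m≢l = off m≢l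
    to : T (anchored f ∧ (h =ᶠ f [ l ]≔ i)) → T ((f =ᶠ h [ l ]≔ Fin.zero) ∧ ((i == h l) ∧ coarseningB h s))
    to t with ∧⁻ {anchored f} t
    ... | anch , h= with ∧⁻ {coarseningB f s} anch
    ... | f≽s , fl=0 =
      ∧⁺ (≗⇒=ᶠ f≗) (∧⁺ (≡⇒== (sym (trans (h≗ l) (updated f l i))))
                       (coarseningB-off-l f h (λ m m≢l → sym (trans (h≗ m) (not-updated f l i m m≢l))) f≽s))
      where
      h≗ : h ≗ f [ l ]≔ i
      h≗ = =ᶠ⇒≗ h=
      f≗ : f ≗ h [ l ]≔ Fin.zero
      f≗ m = byCases m (λ { refl → trans (==⇒≡ fl=0) (sym (updated h l Fin.zero)) })
                       (λ m≢l → trans (sym (trans (h≗ m) (not-updated f l i m m≢l))) (sym (not-updated h l Fin.zero m m≢l)))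
    from : T ((f =ᶠ h [ l ]≔ Fin.zero) ∧ ((i == h l) ∧ coarseningB h s)) → T (anchored f ∧ (h =ᶠ f [ l ]≔ i))
    from t with ∧⁻ {f =ᶠ h [ l ]≔ Fin.zero} t
    ... | f= , rest with ∧⁻ {i == h l} rest
    ... | i=hl , h≽s =
      ∧⁺ (∧⁺ (coarseningB-off-l h f (λ m m≢l → sym (trans (f≗ m) (not-updated h l Fin.zero m m≢l))) h≽s)
             (≡⇒== (trans (f≗ l) (updated h l Fin.zero))))
         (≗⇒=ᶠ h≗)
      where
      f≗ : f ≗ h [ l ]≔ Fin.zero
      f≗ = =ᶠ⇒≗ f=
      h≗ : h ≗ f [ l ]≔ i
      h≗ m = byCases m (λ { refl → trans (sym (==⇒≡ i=hl)) (sym (updated f l i)) })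
                       (λ m≢l → trans (sym (trans (f≗ m) (not-updated h l Fin.zero m m≢l))) (sym (not-updated f l i m m≢l)))

  ∑-free-label : (G : (Fin k → Fin N) → ℚ) → Respects≗ G →
                 ∑Fun k N (λ f → 𝟙 (anchored f) * ∑ (allFin N) (λ i → G (f [ l ]≔ i)))
                   ≡ ∑Fun k N (λ h → 𝟙 (coarseningB h s) * G h)
  ∑-free-label G G-resp = begin
    ∑Fun k N (λ f → 𝟙 (anchored f) * ∑ (allFin N) (λ i → G (f [ l ]≔ i)))
      ≡⟨ ∑Fun-cong (λ f → trans
           (cong (𝟙 (anchored f) *_) (∑-cong (allFin N) (λ i → sym (∑Fun-delta k N (f [ l ]≔ i) G G-resp))))
           (trans (∑-*ˡ (allFin N) (𝟙 (anchored f)) _)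
                  (∑-cong (allFin N) (λ i → ∑-*ˡ (allFuns k N) (𝟙 (anchored f)) _)))) ⟩
    ∑Fun k N (λ f → ∑ (allFin N) (λ i → ∑Fun k N (λ h → 𝟙 (anchored f) * (𝟙 (h =ᶠ f [ l ]≔ i) * G h))))
      ≡⟨ ∑Fun-cong (λ f → ∑-comm (allFin N) (allFuns k N) (λ i h → 𝟙 (anchored f) * (𝟙 (h =ᶠ f [ l ]≔ i) * G h))) ⟩
    ∑Fun k N (λ f → ∑Fun k N (λ h → ∑ (allFin N) (λ i → 𝟙 (anchored f) * (𝟙 (h =ᶠ f [ l ]≔ i) * G h))))
      ≡⟨ ∑-comm (allFuns k N) (allFuns k N) _ ⟩
    ∑Fun k N (λ h → ∑Fun k N (λ f → ∑ (allFin N) (λ i → 𝟙 (anchored f) * (𝟙 (h =ᶠ f [ l ]≔ i) * G h))))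
      ≡⟨ ∑Fun-cong fibre ⟩
    ∑Fun k N (λ h → 𝟙 (coarseningB h s) * G h) ∎
    where
    open ≡-Reasoning
    term : ∀ h f i → 𝟙 (anchored f) * (𝟙 (h =ᶠ f [ l ]≔ i) * G h)
                   ≡ 𝟙 (f =ᶠ h [ l ]≔ Fin.zero) * (𝟙 (i == h l) * (𝟙 (coarseningB h s) * G h))
    term h f i = begin
      𝟙 (anchored f) * (𝟙 (h =ᶠ f [ l ]≔ i) * G h)
        ≡⟨ sym (ℚP.*-assoc (𝟙 (anchored f)) _ (G h)) ⟩
      𝟙 (anchored f) * 𝟙 (h =ᶠ f [ l ]≔ i) * G h
        ≡⟨ cong (_* G h) (trans (sym (𝟙-∧ (anchored f) _)) (reassemble h f i)) ⟩
      𝟙 ((f =ᶠ h [ l ]≔ Fin.zero) ∧ ((i == h l) ∧ coarseningB h s)) * G h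
        ≡⟨ cong (_* G h) (trans (𝟙-∧ (f =ᶠ h [ l ]≔ Fin.zero) _)
                                (cong (𝟙 (f =ᶠ h [ l ]≔ Fin.zero) *_) (𝟙-∧ (i == h l) (coarseningB h s)))) ⟩
      𝟙 (f =ᶠ h [ l ]≔ Fin.zero) * (𝟙 (i == h l) * 𝟙 (coarseningB h s)) * G h
        ≡⟨ ℚP.*-assoc (𝟙 (f =ᶠ h [ l ]≔ Fin.zero)) _ (G h) ⟩
      𝟙 (f =ᶠ h [ l ]≔ Fin.zero) * (𝟙 (i == h l) * 𝟙 (coarseningB h s) * G h)
        ≡⟨ cong (𝟙 (f =ᶠ h [ l ]≔ Fin.zero) *_) (ℚP.*-assoc (𝟙 (i == h l)) _ (G h)) ⟩
      𝟙 (f =ᶠ h [ l ]≔ Fin.zero) * (𝟙 (i == h l) * (𝟙 (coarseningB h s) * G h)) ∎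
    fibre : ∀ h → ∑Fun k N (λ f → ∑ (allFin N) (λ i → 𝟙 (anchored f) * (𝟙 (h =ᶠ f [ l ]≔ i) * G h)))
                ≡ 𝟙 (coarseningB h s) * G h
    fibre h = begin
      ∑Fun k N (λ f → ∑ (allFin N) (λ i → 𝟙 (anchored f) * (𝟙 (h =ᶠ f [ l ]≔ i) * G h)))
        ≡⟨ ∑Fun-cong (λ f → ∑-cong (allFin N) (term h f)) ⟩
      ∑Fun k N (λ f → ∑ (allFin N) (λ i → 𝟙 (f =ᶠ h [ l ]≔ Fin.zero) * (𝟙 (i == h l) * (𝟙 (coarseningB h s) * G h))))
        ≡⟨ ∑Fun-cong (λ f → sym (∑-*ˡ (allFin N) (𝟙 (f =ᶠ h [ l ]≔ Fin.zero)) _)) ⟩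
      ∑Fun k N (λ f → 𝟙 (f =ᶠ h [ l ]≔ Fin.zero) * ∑ (allFin N) (λ i → 𝟙 (i == h l) * (𝟙 (coarseningB h s) * G h)))
        ≡⟨ ∑Fun-cong (λ f → cong (𝟙 (f =ᶠ h [ l ]≔ Fin.zero) *_) (∑-delta N (h l) _)) ⟩
      ∑Fun k N (λ f → 𝟙 (f =ᶠ h [ l ]≔ Fin.zero) * (𝟙 (coarseningB h s) * G h))
        ≡⟨ ∑Fun-delta k N (h [ l ]≔ Fin.zero) (λ _ → 𝟙 (coarseningB h s) * G h) (λ _ → refl) ⟩
      𝟙 (coarseningB h s) * G h ∎

-- Matrix algebra

module _ {n : ℕ} where

  ≈ₘ-refl : {X : Mat n} → X ≈ₘ X
  ≈ₘ-refl i j = refl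

  ≈ₘ-sym : {X Y : Mat n} → X ≈ₘ Y → Y ≈ₘ X
  ≈ₘ-sym X≈Y i j = sym (X≈Y i j)

  ≈ₘ-trans : {X Y Z : Mat n} → X ≈ₘ Y → Y ≈ₘ Z → X ≈ₘ Z
  ≈ₘ-trans X≈Y Y≈Z i j = trans (X≈Y i j) (Y≈Z i j)

  ≡⇒≈ₘ : {X Y : Mat n} → X ≡ Y → X ≈ₘ Y
  ≡⇒≈ₘ refl = ≈ₘ-refl

  +ₘ-cong : {X X′ Y Y′ : Mat n} → X ≈ₘ X′ → Y ≈ₘ Y′ → (X +ₘ Y) ≈ₘ (X′ +ₘ Y′)
  +ₘ-cong X≈X′ Y≈Y′ i j = cong₂ _+_ (X≈X′ i j) (Y≈Y′ i j)

  ·ₘ-cong : ∀ c {X X′ : Mat n} → X ≈ₘ X′ → (c ·ₘ X) ≈ₘ (c ·ₘ X′)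
  ·ₘ-cong c X≈X′ i j = cong (c *_) (X≈X′ i j)

  private
    sumFin-+ : ∀ (f g : Fin n → ℚ) → sumFin n (λ l → f l + g l) ≡ sumFin n f + sumFin n g
    sumFin-+ f g = trans (sym (∑-allFin n _)) (trans (∑-+ (allFin n) f g) (cong₂ _+_ (∑-allFin n f) (∑-allFin n g)))

    sumFin-*ˡ : ∀ c (f : Fin n → ℚ) → c * sumFin n f ≡ sumFin n (λ l → c * f l)
    sumFin-*ˡ c f = trans (cong (c *_) (sym (∑-allFin n f))) (trans (∑-*ˡ (allFin n) c f) (∑-allFin n _))

    sumFin-*ʳ : ∀ c (f : Fin n → ℚ) → sumFin n f * c ≡ sumFin n (λ l → f l * c)
    sumFin-*ʳ c f = trans (cong (_* c) (sym (∑-allFin n f))) (trans (∑-*ʳ (allFin n) c f) (∑-allFin n _))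

    sumFin-neg : ∀ (f : Fin n → ℚ) → sumFin n (λ l → - f l) ≡ - sumFin n f
    sumFin-neg f = trans (sym (∑-allFin n _)) (trans (sym (∑-neg (allFin n) f)) (cong -_ (∑-allFin n f)))

    sumFin-zero : sumFin n (λ _ → 0ℚ) ≡ 0ℚ
    sumFin-zero = trans (sym (∑-allFin n _)) (∑-zero (allFin n) (λ _ → refl))

    sumFin-comm : ∀ (f : Fin n → Fin n → ℚ) → sumFin n (λ i → sumFin n (f i)) ≡ sumFin n (λ j → sumFin n (λ i → f i j))
    sumFin-comm f = begin
      sumFin n (λ i → sumFin n (f i))             ≡⟨ sumFin-cong n (λ i → ∑-allFin n (f i)) ⟨
      sumFin n (λ i → ∑ (allFin n) (f i))         ≡⟨ ∑-allFin n _ ⟨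
      ∑ (allFin n) (λ i → ∑ (allFin n) (f i))     ≡⟨ ∑-comm (allFin n) (allFin n) f ⟩
      ∑ (allFin n) (λ j → ∑ (allFin n) (λ i → f i j)) ≡⟨ ∑-allFin n _ ⟩
      sumFin n (λ j → ∑ (allFin n) (λ i → f i j)) ≡⟨ sumFin-cong n (λ j → ∑-allFin n _) ⟩
      sumFin n (λ j → sumFin n (λ i → f i j))     ∎
      where open ≡-Reasoning

  *ₘ-cong : {X X′ Y Y′ : Mat n} → X ≈ₘ X′ → Y ≈ₘ Y′ → (X *ₘ Y) ≈ₘ (X′ *ₘ Y′)
  *ₘ-cong X≈X′ Y≈Y′ i j = sumFin-cong n (λ l → cong₂ _*_ (X≈X′ i l) (Y≈Y′ l j))

  *ₘ-assoc : (X Y Z : Mat n) → ((X *ₘ Y) *ₘ Z) ≈ₘ (X *ₘ (Y *ₘ Z))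
  *ₘ-assoc X Y Z i j = begin
    sumFin n (λ l → sumFin n (λ m → X i m * Y m l) * Z l j)
      ≡⟨ sumFin-cong n (λ l → trans (sumFin-*ʳ (Z l j) _) (sumFin-cong n (λ m → ℚP.*-assoc (X i m) (Y m l) (Z l j)))) ⟩
    sumFin n (λ l → sumFin n (λ m → X i m * (Y m l * Z l j)))
      ≡⟨ sumFin-comm _ ⟩
    sumFin n (λ m → sumFin n (λ l → X i m * (Y m l * Z l j)))
      ≡⟨ sumFin-cong n (λ m → sumFin-*ˡ (X i m) _) ⟨
    sumFin n (λ m → X i m * sumFin n (λ l → Y m l * Z l j)) ∎
    where open ≡-Reasoning

  *ₘ-linearˡ : ∀ c (X Y Z : Mat n) i j → (((c ·ₘ X) +ₘ Y) *ₘ Z) i j ≡ c * (X *ₘ Z) i j + (Y *ₘ Z) i j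
  *ₘ-linearˡ c X Y Z i j =
    trans (sumFin-cong n (λ l → solve 4 (λ c x y z → (c :* x :+ y) :* z := c :* (x :* z) :+ y :* z) refl c (X i l) (Y i l) (Z l j)))
          (trans (sumFin-+ _ _) (cong (_+ (Y *ₘ Z) i j) (sym (sumFin-*ˡ c _))))
    where open ℚSolver.+-*-Solver

  *ₘ-linearʳ : ∀ c (X Y Z : Mat n) i j → (Z *ₘ ((c ·ₘ X) +ₘ Y)) i j ≡ c * (Z *ₘ X) i j + (Z *ₘ Y) i j
  *ₘ-linearʳ c X Y Z i j =
    trans (sumFin-cong n (λ l → solve 4 (λ c x y z → z :* (c :* x :+ y) := c :* (z :* x) :+ z :* y) refl c (X l j) (Y l j) (Z i l)))
          (trans (sumFin-+ _ _) (cong (_+ (Z *ₘ Y) i j) (sym (sumFin-*ˡ c _))))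
    where open ℚSolver.+-*-Solver

  *ₘ-zeroˡ : (Y : Mat n) → (0ₘ *ₘ Y) ≈ₘ 0ₘ
  *ₘ-zeroˡ Y i j = trans (sumFin-cong n (λ l → ℚP.*-zeroˡ (Y l j))) sumFin-zero

  *ₘ-zeroʳ : (X : Mat n) → (X *ₘ 0ₘ) ≈ₘ 0ₘ
  *ₘ-zeroʳ X i j = trans (sumFin-cong n (λ l → ℚP.*-zeroʳ (X i l))) sumFin-zero

  *ₘ-minusˡ : (X X′ Y : Mat n) → ((X -ₘ X′) *ₘ Y) ≈ₘ ((X *ₘ Y) -ₘ (X′ *ₘ Y))
  *ₘ-minusˡ X X′ Y i j =
    trans (sumFin-cong n (λ l → solve 3 (λ a b c → (a :- b) :* c := a :* c :+ (:- (b :* c))) refl (X i l) (X′ i l) (Y l j)))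
          (trans (sumFin-+ _ _) (cong ((X *ₘ Y) i j +_) (sumFin-neg _)))
    where open ℚSolver.+-*-Solver

  *ₘ-minusʳ : (X Y Y′ : Mat n) → (X *ₘ (Y -ₘ Y′)) ≈ₘ ((X *ₘ Y) -ₘ (X *ₘ Y′))
  *ₘ-minusʳ X Y Y′ i j =
    trans (sumFin-cong n (λ l → solve 3 (λ a b c → a :* (b :- c) := a :* b :+ (:- (a :* c))) refl (X i l) (Y l j) (Y′ l j)))
          (trans (sumFin-+ _ _) (cong ((X *ₘ Y) i j +_) (sumFin-neg _)))
    where open ℚSolver.+-*-Solver

  ⁅⁆-cong : {X X′ Y Y′ : Mat n} → X ≈ₘ X′ → Y ≈ₘ Y′ → ⁅ X , Y ⁆ ≈ₘ ⁅ X′ , Y′ ⁆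
  ⁅⁆-cong X≈X′ Y≈Y′ i j = cong₂ _-_ (*ₘ-cong X≈X′ Y≈Y′ i j) (*ₘ-cong Y≈Y′ X≈X′ i j)

  ⁅⁆-linearˡ : ∀ W c (Y Z : Mat n) → ⁅ (c ·ₘ Y) +ₘ Z , W ⁆ ≈ₘ ((c ·ₘ ⁅ Y , W ⁆) +ₘ ⁅ Z , W ⁆)
  ⁅⁆-linearˡ W c Y Z i j = trans (cong₂ _-_ (*ₘ-linearˡ c Y Z W i j) (*ₘ-linearʳ c Y Z W i j))
    (solve 5 (λ c a b d e → (c :* a :+ b) :- (c :* d :+ e) := c :* (a :- d) :+ (b :- e)) refl
       c ((Y *ₘ W) i j) ((Z *ₘ W) i j) ((W *ₘ Y) i j) ((W *ₘ Z) i j))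
    where open ℚSolver.+-*-Solver

  ⁅⁆-linearʳ : ∀ X c (Y Z : Mat n) → ⁅ X , (c ·ₘ Y) +ₘ Z ⁆ ≈ₘ ((c ·ₘ ⁅ X , Y ⁆) +ₘ ⁅ X , Z ⁆)
  ⁅⁆-linearʳ X c Y Z i j = trans (cong₂ _-_ (*ₘ-linearʳ c Y Z X i j) (*ₘ-linearˡ c Y Z X i j))
    (solve 5 (λ c a b d e → (c :* a :+ b) :- (c :* d :+ e) := c :* (a :- d) :+ (b :- e)) refl
       c ((X *ₘ Y) i j) ((X *ₘ Z) i j) ((Y *ₘ X) i j) ((Z *ₘ X) i j))
    where open ℚSolver.+-*-Solver

  ⁅⁆-zeroˡ : (Y : Mat n) → ⁅ 0ₘ , Y ⁆ ≈ₘ 0ₘ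
  ⁅⁆-zeroˡ Y i j = cong₂ _-_ (*ₘ-zeroˡ Y i j) (*ₘ-zeroʳ Y i j)

  ⁅⁆-zeroʳ : (X : Mat n) → ⁅ X , 0ₘ ⁆ ≈ₘ 0ₘ
  ⁅⁆-zeroʳ X i j = cong₂ _-_ (*ₘ-zeroʳ X i j) (*ₘ-zeroˡ X i j)

  jacobi : (Y Z W : Mat n) → ⁅ Y , ⁅ Z , W ⁆ ⁆ ≈ₘ (⁅ ⁅ Y , Z ⁆ , W ⁆ -ₘ ⁅ ⁅ Y , W ⁆ , Z ⁆)
  jacobi Y Z W i j = trans lhs (trans (solve 6 (λ a₁ a₂ a₃ a₄ a₅ a₆ →
      (a₁ :- a₂) :- (a₃ :- a₄) := ((a₁ :- a₅) :- (a₆ :- a₄)) :- ((a₂ :- a₆) :- (a₅ :- a₃)))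
      refl (YZW i j) (YWZ i j) (ZWY i j) (WZY i j) (ZYW i j) (WYZ i j)) (sym rhs))
    where
    open ℚSolver.+-*-Solver
    triple : Mat n → Mat n → Mat n → Mat n
    triple A B C = (A *ₘ B) *ₘ C
    YZW YWZ ZWY WZY ZYW WYZ : Mat n
    YZW = triple Y Z W
    YWZ = triple Y W Z
    ZWY = triple Z W Y
    WZY = triple W Z Y
    ZYW = triple Z Y W
    WYZ = triple W Y Z
    left-assoc : ∀ A B C → (A *ₘ (B *ₘ C)) i j ≡ triple A B C i j
    left-assoc A B C = sym (*ₘ-assoc A B C i j)
    lhs : ⁅ Y , ⁅ Z , W ⁆ ⁆ i j ≡ (YZW i j - YWZ i j) - (ZWY i j - WZY i j)
    lhs = cong₂ _-_ (trans (*ₘ-minusʳ Y (Z *ₘ W) (W *ₘ Z) i j) (cong₂ _-_ (left-assoc Y Z W) (left-assoc Y W Z)))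
                    (*ₘ-minusˡ (Z *ₘ W) (W *ₘ Z) Y i j)
    rhs : (⁅ ⁅ Y , Z ⁆ , W ⁆ -ₘ ⁅ ⁅ Y , W ⁆ , Z ⁆) i j
          ≡ ((YZW i j - ZYW i j) - (WYZ i j - WZY i j)) - ((YWZ i j - WYZ i j) - (ZYW i j - ZWY i j))
    rhs = cong₂ _-_
      (cong₂ _-_ (*ₘ-minusˡ (Y *ₘ Z) (Z *ₘ Y) W i j)
                 (trans (*ₘ-minusʳ W (Y *ₘ Z) (Z *ₘ Y) i j) (cong₂ _-_ (left-assoc W Y Z) (left-assoc W Z Y))))
      (cong₂ _-_ (*ₘ-minusˡ (Y *ₘ W) (W *ₘ Y) Z i j)
                 (trans (*ₘ-minusʳ Z (Y *ₘ W) (W *ₘ Y) i j) (cong₂ _-_ (left-assoc Z Y W) (left-assoc Z W Y))))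

record IsLinear {n : ℕ} (F : Mat n → Mat n) : Set where
  field
    F-cong   : ∀ {X Y} → X ≈ₘ Y → F X ≈ₘ F Y
    F-zero   : F 0ₘ ≈ₘ 0ₘ
    F-linear : ∀ c Y Z → F ((c ·ₘ Y) +ₘ Z) ≈ₘ ((c ·ₘ F Y) +ₘ F Z)

module _ {n : ℕ} where

  ⁅-,⁆-linear : (W : Mat n) → IsLinear (λ X → ⁅ X , W ⁆)
  ⁅-,⁆-linear W = record { F-cong = λ X≈Y → ⁅⁆-cong X≈Y ≈ₘ-refl ; F-zero = ⁅⁆-zeroˡ W ; F-linear = ⁅⁆-linearˡ W }

  ⁅,-⁆-linear : (X : Mat n) → IsLinear (λ Y → ⁅ X , Y ⁆)
  ⁅,-⁆-linear X = record { F-cong = ⁅⁆-cong ≈ₘ-refl ; F-zero = ⁅⁆-zeroʳ X ; F-linear = ⁅⁆-linearʳ X }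

  ·ₘ-linear : ∀ a → IsLinear (_·ₘ_ {n} a)
  ·ₘ-linear a = record
    { F-cong   = ·ₘ-cong a
    ; F-zero   = λ i j → ℚP.*-zeroʳ a
    ; F-linear = λ c Y Z i j → solve 4 (λ a c y z → a :* (c :* y :+ z) := c :* (a :* y) :+ a :* z) refl a c (Y i j) (Z i j)
    }
    where open ℚSolver.+-*-Solver

  id-linear : IsLinear {n} (λ X → X)
  id-linear = record { F-cong = λ X≈Y → X≈Y ; F-zero = ≈ₘ-refl ; F-linear = λ _ _ _ → ≈ₘ-refl }

  IsLinear-∘ : {F G : Mat n → Mat n} → IsLinear F → IsLinear G → IsLinear (F ∘ G)
  IsLinear-∘ {F} {G} lin-F lin-G = record
    { F-cong   = F.F-cong ∘ G.F-cong
    ; F-zero   = ≈ₘ-trans (F.F-cong G.F-zero) F.F-zero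
    ; F-linear = λ c Y Z → ≈ₘ-trans (F.F-cong (G.F-linear c Y Z)) (F.F-linear c (G Y) (G Z))
    }
    where
    module F = IsLinear lin-F
    module G = IsLinear lin-G

  foldl-linear : (Ws : List (Mat n)) → IsLinear (λ X → foldl ⁅_,_⁆ X Ws)
  foldl-linear []       = id-linear
  foldl-linear (W ∷ Ws) = IsLinear-∘ (foldl-linear Ws) (⁅-,⁆-linear W)

  linear-sumₘ : {F : Mat n → Mat n} → IsLinear F → ∀ Xs → F (sumₘ Xs) ≈ₘ sumₘ (map F Xs)
  linear-sumₘ lin-F []       = F-zero
    where open IsLinear lin-F
  linear-sumₘ {F} lin-F (X ∷ Xs) =
    ≈ₘ-trans (F-cong (+ₘ-cong (λ i j → sym (ℚP.*-identityˡ (X i j))) ≈ₘ-refl))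
      (≈ₘ-trans (F-linear 1ℚ X (sumₘ Xs))
        (+ₘ-cong (λ i j → ℚP.*-identityˡ (F X i j)) (linear-sumₘ lin-F Xs)))
    where open IsLinear lin-F

  sumₘ-entry : ∀ (Xs : List (Mat n)) i j → sumₘ Xs i j ≡ ∑ Xs (λ X → X i j)
  sumₘ-entry []       i j = refl
  sumₘ-entry (X ∷ Xs) i j = cong (X i j +_) (sumₘ-entry Xs i j)

  sumₘ-map-entry : ∀ {A : Set} (F : A → Mat n) (xs : List A) i j → sumₘ (map F xs) i j ≡ ∑ xs (λ a → F a i j)
  sumₘ-map-entry F xs i j = trans (sumₘ-entry (map F xs) i j) (∑-map F xs (λ X → X i j))

  sumFinₘ-comm-sumₘ : ∀ {N} {A : Set} (F : Fin N → A → Mat n) (xs : List A) →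
    sumFinₘ N (λ i → sumₘ (map (F i) xs)) ≈ₘ sumₘ (map (λ a → sumFinₘ N (λ i → F i a)) xs)
  sumFinₘ-comm-sumₘ {N} F xs r c = begin
    sumFinₘ N (λ i → sumₘ (map (F i) xs)) r c
      ≡⟨ sumₘ-map-entry _ (allFin N) r c ⟩
    ∑ (allFin N) (λ i → sumₘ (map (F i) xs) r c)
      ≡⟨ ∑-cong (allFin N) (λ i → sumₘ-map-entry (F i) xs r c) ⟩
    ∑ (allFin N) (λ i → ∑ xs (λ a → F i a r c))
      ≡⟨ ∑-comm (allFin N) xs (λ i a → F i a r c) ⟩
    ∑ xs (λ a → ∑ (allFin N) (λ i → F i a r c))
      ≡⟨ ∑-cong xs (λ a → sumₘ-map-entry (λ i → F i a) (allFin N) r c) ⟨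
    ∑ xs (λ a → sumFinₘ N (λ i → F i a) r c)
      ≡⟨ sumₘ-map-entry _ xs r c ⟨
    sumₘ (map (λ a → sumFinₘ N (λ i → F i a)) xs) r c ∎
    where open ≡-Reasoning

  sumFinₘ-cong : ∀ N {A B : Fin N → Mat n} → (∀ i → A i ≈ₘ B i) → sumFinₘ N A ≈ₘ sumFinₘ N B
  sumFinₘ-cong N A≈B r c = trans (sumₘ-map-entry _ (allFin N) r c)
    (trans (∑-cong (allFin N) (λ i → A≈B i r c)) (sym (sumₘ-map-entry _ (allFin N) r c)))

  linear-sumFinₘ : ∀ {N} {F : Mat n → Mat n} → IsLinear F → (A : Fin N → Mat n) →
                   sumFinₘ N (F ∘ A) ≈ₘ F (sumFinₘ N A)
  linear-sumFinₘ {N} lin-F A = ≈ₘ-sym (≈ₘ-trans (linear-sumₘ lin-F (map A (allFin N)))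
                                                (≡⇒≈ₘ (cong sumₘ (sym (ListP.map-∘ (allFin N))))))

module _ {n : ℕ} where

  Span : (Mat n → Set) → Mat n → Set
  Span P X = ∃ λ Z → LinComb P Z × (X ≈ₘ Z)

  module _ {P : Mat n → Set} where

    Span-≈ : ∀ {X Y} → X ≈ₘ Y → Span P Y → Span P X
    Span-≈ X≈Y (Z , lc , Y≈Z) = Z , lc , ≈ₘ-trans X≈Y Y≈Z

    Span-0 : Span P 0ₘ
    Span-0 = 0ₘ , nil , ≈ₘ-refl

    Span-gen : ∀ {Y} → P Y → Span P Y
    Span-gen {Y} PY = (1ℚ ·ₘ Y) +ₘ 0ₘ , cons 1ℚ PY nil ,
      (λ i j → sym (trans (ℚP.+-identityʳ (1ℚ * Y i j)) (ℚP.*-identityˡ (Y i j))))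

    private
      append : ∀ {Z₁ Z₂} → LinComb P Z₁ → LinComb P Z₂ → Span P (Z₁ +ₘ Z₂)
      append {Z₂ = Z₂} nil lc₂ = Z₂ , lc₂ , λ i j → ℚP.+-identityˡ (Z₂ i j)
      append (cons {Y} {Z} c PY lc₁) lc₂ with append lc₁ lc₂
      ... | Z′ , lc′ , Z+Z₂≈Z′ = (c ·ₘ Y) +ₘ Z′ , cons c PY lc′ ,
        λ i j → trans (ℚP.+-assoc (c * Y i j) (Z i j) _) (cong (c * Y i j +_) (Z+Z₂≈Z′ i j))

      scale : ∀ c {Z} → LinComb P Z → Span P (c ·ₘ Z)
      scale c nil = 0ₘ , nil , λ i j → ℚP.*-zeroʳ c
      scale c (cons {Y} {Z} c′ PY lc) with scale c lc
      ... | Z′ , lc′ , cZ≈Z′ = ((c * c′) ·ₘ Y) +ₘ Z′ , cons (c * c′) PY lc′ ,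
        λ i j → trans (ℚP.*-distribˡ-+ c (c′ * Y i j) (Z i j)) (cong₂ _+_ (sym (ℚP.*-assoc c c′ (Y i j))) (cZ≈Z′ i j))

    Span-+ : ∀ {X Y} → Span P X → Span P Y → Span P (X +ₘ Y)
    Span-+ (Z₁ , lc₁ , X≈Z₁) (Z₂ , lc₂ , Y≈Z₂) = Span-≈ (+ₘ-cong X≈Z₁ Y≈Z₂) (append lc₁ lc₂)

    Span-· : ∀ c {X} → Span P X → Span P (c ·ₘ X)
    Span-· c (Z , lc , X≈Z) = Span-≈ (·ₘ-cong c X≈Z) (scale c lc)

    Span-minus : ∀ {X Y} → Span P X → Span P Y → Span P (X -ₘ Y)
    Span-minus {X} {Y} span-X span-Y =
      Span-≈ (λ i j → solve 2 (λ a b → a :- b := a :+ (:- con 1ℚ) :* b) refl (X i j) (Y i j))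
             (Span-+ span-X (Span-· (- 1ℚ) span-Y))
      where open ℚSolver.+-*-Solver

    Span-sumₘ : ∀ {A : Set} (F : A → Mat n) {xs : List A} → All (Span P ∘ F) xs → Span P (sumₘ (map F xs))
    Span-sumₘ F All.[]              = Span-0
    Span-sumₘ F (span-Fa All.∷ span-Fxs) = Span-+ span-Fa (Span-sumₘ F span-Fxs)

  Span-mono : ∀ {P Q : Mat n → Set} → (∀ {Y} → P Y → Q Y) → ∀ {X} → Span P X → Span Q X
  Span-mono {P} {Q} P⇒Q (Z , lc , X≈Z) = Z , go lc , X≈Z
    where
    go : ∀ {Z} → LinComb P Z → LinComb Q Z
    go nil             = nil
    go (cons c PY lc)  = cons c (P⇒Q PY) (go lc)

  Span-linear : ∀ {P Q : Mat n → Set} {F : Mat n → Mat n} → IsLinear F →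
                (∀ {Y} → P Y → Span Q (F Y)) → ∀ {X} → Span P X → Span Q (F X)
  Span-linear {P} {Q} {F} lin-F on-gen (Z , lc , X≈Z) = Span-≈ (F-cong X≈Z) (go lc)
    where
    open IsLinear lin-F
    go : ∀ {Z} → LinComb P Z → Span Q (F Z)
    go nil            = Span-≈ F-zero Span-0
    go (cons c PY lc) = Span-≈ (F-linear c _ _) (Span-+ (Span-· c (on-gen PY)) (go lc))

  Span-⁅⁆ : ∀ {P P′ Q : Mat n → Set} → (∀ {Y Y′} → P Y → P′ Y′ → Span Q ⁅ Y , Y′ ⁆) →
            ∀ {X W} → Span P X → Span P′ W → Span Q ⁅ X , W ⁆
  Span-⁅⁆ on-gens {X} {W} span-X span-W =
    Span-linear (⁅-,⁆-linear W) (λ {Y} PY → Span-linear (⁅,-⁆-linear Y) (on-gens PY) span-W) span-X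

-- Left-normed brackets with one distinguished slot

module _ {n : ℕ} where

  bracketAfter : List (Mat n) → Mat n → Mat n
  bracketAfter []       Y = Y
  bracketAfter (X ∷ Xs) Y = ⁅ foldl ⁅_,_⁆ X Xs , Y ⁆

  lbr-++-∷ : ∀ Xs Y Ys → lbr (Xs ++ Y ∷ Ys) ≡ foldl ⁅_,_⁆ (bracketAfter Xs Y) Ys
  lbr-++-∷ []       Y Ys = refl
  lbr-++-∷ (X ∷ Xs) Y Ys = ListP.foldl-++ ⁅_,_⁆ X Xs (Y ∷ Ys)

  bracketAfter-linear : ∀ Xs → IsLinear (bracketAfter Xs)
  bracketAfter-linear []       = id-linear
  bracketAfter-linear (X ∷ Xs) = ⁅,-⁆-linear (foldl ⁅_,_⁆ X Xs)

  lbr-sum-in-slot : ∀ {N} Xs (A : Fin N → Mat n) Ys →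
                    sumFinₘ N (λ i → lbr (Xs ++ A i ∷ Ys)) ≈ₘ lbr (Xs ++ sumFinₘ N A ∷ Ys)
  lbr-sum-in-slot {N} Xs A Ys =
    ≈ₘ-trans (sumFinₘ-cong N (λ i → ≡⇒≈ₘ (lbr-++-∷ Xs (A i) Ys)))
      (≈ₘ-trans (linear-sumFinₘ (IsLinear-∘ (foldl-linear Ys) (bracketAfter-linear Xs)) A)
                (≡⇒≈ₘ (sym (lbr-++-∷ Xs (sumFinₘ N A) Ys))))

module _ {n : ℕ} (𝓢 : Mat n → Set) where

  InL≥-≈ : ∀ {j X Y} → X ≈ₘ Y → InL≥ 𝓢 j Y → InL≥ 𝓢 j X
  InL≥-≈ = Span-≈

  InL≥-mono : ∀ {a b X} → a ≤ b → InL≥ 𝓢 b X → InL≥ 𝓢 a X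
  InL≥-mono a≤b = Span-mono (λ { (i , b≤i , br) → i , ℕP.≤-trans a≤b b≤i , br })

  InL≥-reindex : ∀ {a b X} → a ≡ b → InL≥ 𝓢 b X → InL≥ 𝓢 a X
  InL≥-reindex a≡b = InL≥-mono (ℕP.≤-reflexive a≡b)

  InL≥-⁅,gen⁆ : ∀ {m X W} → InL≥ 𝓢 m X → 𝓢 W → InL≥ 𝓢 (suc m) ⁅ X , W ⁆
  InL≥-⁅,gen⁆ {W = W} X∈ W∈𝓢 =
    Span-linear (⁅-,⁆-linear W) (λ { (i , m≤i , br) → Span-gen (suc i , s≤s m≤i , step br W∈𝓢) }) X∈

  -- By Jacobi, a bracket with a left-normed bracket of length j + 1 splits into two with length j.
  Bracket-⁅⁆ : ∀ {i j Y Z} → Bracket 𝓢 i Y → Bracket 𝓢 j Z → InL≥ 𝓢 (i ℕ.+ j) ⁅ Y , Z ⁆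
  Bracket-⁅⁆ {i} Y-br (base W∈𝓢) = Span-gen (suc i , ℕP.≤-reflexive (ℕP.+-comm i 1) , step Y-br W∈𝓢)
  Bracket-⁅⁆ {i} {Y = Y} Y-br (step {j} {Z} {W} Z-br W∈𝓢) =
    InL≥-reindex (ℕP.+-suc i j)
      (InL≥-≈ (jacobi Y Z W) (Span-minus (InL≥-⁅,gen⁆ (Bracket-⁅⁆ Y-br Z-br) W∈𝓢) (Bracket-⁅⁆ (step Y-br W∈𝓢) Z-br)))

  InL≥-⁅⁆ : ∀ {a b X W} → InL≥ 𝓢 a X → InL≥ 𝓢 b W → InL≥ 𝓢 (a ℕ.+ b) ⁅ X , W ⁆
  InL≥-⁅⁆ = Span-⁅⁆ (λ { (i , a≤i , Y-br) (j , b≤j , Y′-br) → InL≥-mono (ℕP.+-mono-≤ a≤i b≤j) (Bracket-⁅⁆ Y-br Y′-br) })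

  InL≥-foldl : ∀ {e B} Ws → All (InL≥ 𝓢 1) Ws → InL≥ 𝓢 e B → InL≥ 𝓢 (e ℕ.+ length Ws) (foldl ⁅_,_⁆ B Ws)
  InL≥-foldl {e} []       All.[]       B∈ = InL≥-reindex (ℕP.+-identityʳ e) B∈
  InL≥-foldl {e} (W ∷ Ws) (W∈ All.∷ Ws∈) B∈ =
    InL≥-reindex (sym (ℕP.+-assoc e 1 (length Ws))) (InL≥-foldl Ws Ws∈ (InL≥-⁅⁆ B∈ W∈))

  InL≥-bracketAfter : ∀ {d Y} Xs → All (InL≥ 𝓢 1) Xs → InL≥ 𝓢 d Y → InL≥ 𝓢 (length Xs ℕ.+ d) (bracketAfter Xs Y)
  InL≥-bracketAfter []       All.[]         Y∈ = Y∈
  InL≥-bracketAfter (X ∷ Xs) (X∈ All.∷ Xs∈) Y∈ = InL≥-⁅⁆ (InL≥-foldl Xs Xs∈ X∈) Y∈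

  InL≥-lbr-slot : ∀ {d Y} Xs Ys → All (InL≥ 𝓢 1) Xs → InL≥ 𝓢 d Y → All (InL≥ 𝓢 1) Ys →
                  InL≥ 𝓢 (length Xs ℕ.+ d ℕ.+ length Ys) (lbr (Xs ++ Y ∷ Ys))
  InL≥-lbr-slot {Y = Y} Xs Ys Xs∈ Y∈ Ys∈ =
    subst (InL≥ 𝓢 _) (sym (lbr-++-∷ Xs Y Ys)) (InL≥-foldl Ys Ys∈ (InL≥-bracketAfter Xs Xs∈ Y∈))

-- Where the free label sits among the arguments of a bracket

injective⇒surjective : ∀ {k} (τ : Fin k → Fin k) → (∀ a b → τ a ≡ τ b → a ≡ b) → ∀ l → ∃ λ p → τ p ≡ l
injective⇒surjective {suc k} τ τ-inj l with Data.Fin.Properties.any? (λ p → τ p ≟ l)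
... | yes hit = hit
... | no  ∄p  = ⊥-elim (ℕP.<-irrefl refl (Data.Fin.Properties.injective⇒≤ {f = squeeze}
                 (λ {a} {b} eq → τ-inj a b (Data.Fin.Properties.punchOut-injective (missed a) (missed b) eq))))
  where
  missed : ∀ p → l ≢ τ p
  missed p l≡τp = ∄p (p , sym l≡τp)
  squeeze : Fin (suc k) → Fin k
  squeeze p = Fin.punchOut (missed p)

Unique-split : ∀ {A : Set} {xs : List A} {x} → Unique xs → x ∈ xs →
               ∃ λ as → ∃ λ bs → xs ≡ as ++ x ∷ bs × x ∉ as × x ∉ bs
Unique-split {xs = x ∷ xs} u (here refl) = [] , xs , refl , (λ ()) , UniqueP.Unique[x∷xs]⇒x∉xs u
Unique-split {xs = y ∷ xs} (y≢ AllPairs.∷ u) (there x∈xs) with Unique-split u x∈xs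
... | as , bs , xs≡ , x∉as , x∉bs = y ∷ as , bs , cong (y ∷_) xs≡ , x∉y∷as , x∉bs
  where
  x∉y∷as : _ ∉ y ∷ as
  x∉y∷as (here x≡y)  = All.lookup y≢ x∈xs (sym x≡y)
  x∉y∷as (there x∈as) = x∉as x∈as

map-updateAt-∉ : ∀ {k N} (f : Fin k → Fin N) l i as → l ∉ as → map (f [ l ]≔ i) as ≡ map f as
map-updateAt-∉ f l i []       l∉ = refl
map-updateAt-∉ f l i (a ∷ as) l∉ =
  cong₂ _∷_ (not-updated f l i a (λ a≡l → l∉ (here (sym a≡l)))) (map-updateAt-∉ f l i as (l∉ ∘ there))

relabel-slot : ∀ {k N} (f : Fin k → Fin N) l (τ : Fin k → Fin k) → (∀ a b → τ a ≡ τ b → a ≡ b) →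
               ∃ λ Xs → ∃ λ Ys → suc (length Xs ℕ.+ length Ys) ≡ k ×
                 (∀ i → map ((f [ l ]≔ i) ∘ τ) (allFin k) ≡ Xs ++ i ∷ Ys)
relabel-slot {k} f l τ τ-inj
  with Unique-split (UniqueP.map⁺ (λ {a} {b} → τ-inj a b) (UniqueP.allFin⁺ k)) l∈τs
  where
  l∈τs : l ∈ map τ (allFin k)
  l∈τs = let p , τp≡l = injective⇒surjective τ τ-inj l
         in subst (_∈ map τ (allFin k)) τp≡l (∈-map⁺ τ (∈-allFin p))
... | as , bs , τs≡ , l∉as , l∉bs = map f as , map f bs , size , slot
  where
  size : suc (length (map f as) ℕ.+ length (map f bs)) ≡ k
  size = begin
    suc (length (map f as) ℕ.+ length (map f bs)) ≡⟨ cong₂ (λ x y → suc (x ℕ.+ y)) (ListP.length-map f as) (ListP.length-map f bs) ⟩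
    suc (length as ℕ.+ length bs)                 ≡⟨ trans (ListP.length-++-sucʳ as l bs) (cong suc (ListP.length-++ as)) ⟨
    length (as ++ l ∷ bs)                         ≡⟨ cong length τs≡ ⟨
    length (map τ (allFin k))                     ≡⟨ ListP.length-map τ (allFin k) ⟩
    length (allFin k)                             ≡⟨ ListP.length-tabulate (λ i → i) ⟩
    k ∎
    where open ≡-Reasoning
  slot : ∀ i → map ((f [ l ]≔ i) ∘ τ) (allFin k) ≡ map f as ++ i ∷ map f bs
  slot i = begin
    map ((f [ l ]≔ i) ∘ τ) (allFin k)                       ≡⟨ ListP.map-∘ (allFin k) ⟩
    map (f [ l ]≔ i) (map τ (allFin k))                     ≡⟨ cong (map (f [ l ]≔ i)) τs≡ ⟩
    map (f [ l ]≔ i) (as ++ l ∷ bs)                         ≡⟨ ListP.map-++ (f [ l ]≔ i) as (l ∷ bs) ⟩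
    map (f [ l ]≔ i) as ++ (f [ l ]≔ i) l ∷ map (f [ l ]≔ i) bs
      ≡⟨ cong₂ _++_ (map-updateAt-∉ f l i as l∉as)
                    (cong₂ _∷_ (updated f l i) (map-updateAt-∉ f l i bs l∉bs)) ⟩
    map f as ++ i ∷ map f bs ∎
    where open ≡-Reasoning

-- The Lie-algebraic core: summing φ over the free label puts ∑ C, of degree ≥ 2, into one slot

descentCoefficient : ∀ k → (Fin k → Fin k) → ℚ
descentCoefficient k τ = sign (descents τ) ÷ℕ (k ℕ.* k ℕ.* binom (k ∸ 1) (descents τ))

φ-cong : ∀ {n} k {X Y : Fin k → Mat n} → X ≗ Y → φ k X ≡ φ k Y
φ-cong k X≗Y = cong sumₘ (ListP.map-cong (λ τ → cong (descentCoefficient k τ ·ₘ_)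
                                              (cong lbr (ListP.map-cong (X≗Y ∘ τ) (allFin k))))
                                          (perms k))

module _ {n : ℕ} (𝓢 : Mat n → Set) {N : ℕ} (C : Fin N → Mat n)
         (C∈ : ∀ i → InL≥ 𝓢 1 (C i)) (∑C∈ : InL≥ 𝓢 2 (sumFinₘ N C)) where

  lbr-sum-over-label : ∀ {k} (f : Fin k → Fin N) l (τ : Fin k → Fin k) → (∀ a b → τ a ≡ τ b → a ≡ b) →
    InL≥ 𝓢 (suc k) (sumFinₘ N (λ i → lbr (map (λ p → C ((f [ l ]≔ i) (τ p))) (allFin k))))
  lbr-sum-over-label {k} f l τ τ-inj with relabel-slot f l τ τ-inj
  ... | Xs , Ys , size , slot =
    InL≥-≈ 𝓢 (≈ₘ-trans (sumFinₘ-cong N (λ i → ≡⇒≈ₘ (cong lbr (in-slot i)))) (lbr-sum-in-slot (map C Xs) C (map C Ys)))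
      (InL≥-reindex 𝓢 degree
        (InL≥-lbr-slot 𝓢 (map C Xs) (map C Ys) (AllP.map⁺ (All.universal (C∈ ∘ _) Xs)) ∑C∈
                       (AllP.map⁺ (All.universal (C∈ ∘ _) Ys))))
    where
    in-slot : ∀ i → map (λ p → C ((f [ l ]≔ i) (τ p))) (allFin k) ≡ map C Xs ++ C i ∷ map C Ys
    in-slot i = trans (ListP.map-∘ (allFin k)) (trans (cong (map C) (slot i)) (ListP.map-++ C Xs (i ∷ Ys)))
    degree : suc k ≡ length (map C Xs) ℕ.+ 2 ℕ.+ length (map C Ys)
    degree = begin
      suc k                                          ≡⟨ cong suc size ⟨
      suc (suc (length Xs ℕ.+ length Ys))            ≡⟨ trans (ℕP.+-suc (length Xs) (suc (length Ys))) (cong suc (ℕP.+-suc (length Xs) (length Ys))) ⟨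
      length Xs ℕ.+ (2 ℕ.+ length Ys)                ≡⟨ ℕP.+-assoc (length Xs) 2 (length Ys) ⟨
      length Xs ℕ.+ 2 ℕ.+ length Ys                  ≡⟨ cong₂ (λ x y → x ℕ.+ 2 ℕ.+ y) (ListP.length-map C Xs) (ListP.length-map C Ys) ⟨
      length (map C Xs) ℕ.+ 2 ℕ.+ length (map C Ys) ∎
      where open ≡-Reasoning

  φ-sum-over-label : ∀ {k} (f : Fin k → Fin N) l → InL≥ 𝓢 (suc k) (sumFinₘ N (λ i → φ k (C ∘ (f [ l ]≔ i))))
  φ-sum-over-label {k} f l =
    InL≥-≈ 𝓢 (sumFinₘ-comm-sumₘ term (perms k))
      (Span-sumₘ (λ τ → sumFinₘ N (λ i → term i τ)) (All.tabulate λ {τ} τ∈perms →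
        InL≥-≈ 𝓢 (linear-sumFinₘ (·ₘ-linear (descentCoefficient k τ)) (λ i → lbr (arguments i τ)))
          (Span-· (descentCoefficient k τ)
            (lbr-sum-over-label f l τ (isInjective⇒injective τ
              (proj₂ (∈-filter⁻ (T? ∘ isInjective) {xs = allFuns k k} τ∈perms)))))))
    where
    arguments : Fin N → (Fin k → Fin k) → List (Mat n)
    arguments i τ = map (λ p → C ((f [ l ]≔ i) (τ p))) (allFin k)
    term : Fin N → (Fin k → Fin k) → Mat n
    term i τ = descentCoefficient k τ ·ₘ lbr (arguments i τ)

module _ {n k : ℕ} (C : Fin (suc k) → Mat n) (s : Fin k → Fin (suc k))
         (l : Fin k) (singleton : ∀ m → s m ≡ s l → m ≡ l) where

  open SingletonBlock s l singleton using (anchored; ∑-free-label)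

  coarseningSum≈free-label :
    coarseningSum k C s ≈ₘ sumₘ (map (λ f → 𝟙 (anchored f) ·ₘ sumFinₘ (suc k) (λ i → φ k (C ∘ (f [ l ]≔ i))))
                                     (allFuns k (suc k)))
  coarseningSum≈free-label r c = begin
    coarseningSum k C s r c
      ≡⟨ sumₘ-map-entry (Φ k C) (coarsenings k s) r c ⟩
    ∑ (coarsenings k s) (λ g → Φ k C g r c)
      ≡⟨ ∑-cong (coarsenings k s) (λ g → cong (weight g *_) (sumₘ-map-entry (λ σ → φ k (C ∘ (σ ∘ g))) (perms (suc k)) r c)) ⟩
    ∑ (coarsenings k s) (λ g → weight g * ∑ (perms (suc k)) (λ σ → G (σ ∘ g)))
      ≡⟨ ∑-coarsenings s G G-resp ⟩
    ∑Fun k (suc k) (λ f → 𝟙 (coarseningB f s) * G f)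
      ≡⟨ ∑-free-label G G-resp ⟨
    ∑Fun k (suc k) (λ f → 𝟙 (anchored f) * ∑ (allFin (suc k)) (λ i → G (f [ l ]≔ i)))
      ≡⟨ ∑-cong (allFuns k (suc k)) (λ f → cong (𝟙 (anchored f) *_) (sumₘ-map-entry (λ i → φ k (C ∘ (f [ l ]≔ i))) (allFin (suc k)) r c)) ⟨
    ∑Fun k (suc k) (λ f → 𝟙 (anchored f) * sumFinₘ (suc k) (λ i → φ k (C ∘ (f [ l ]≔ i))) r c)
      ≡⟨ sumₘ-map-entry (λ f → 𝟙 (anchored f) ·ₘ sumFinₘ (suc k) (λ i → φ k (C ∘ (f [ l ]≔ i)))) (allFuns k (suc k)) r c ⟨
    sumₘ (map (λ f → 𝟙 (anchored f) ·ₘ sumFinₘ (suc k) (λ i → φ k (C ∘ (f [ l ]≔ i))))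
              (allFuns k (suc k))) r c ∎
    where
    open ≡-Reasoning
    G : (Fin k → Fin (suc k)) → ℚ
    G h = φ k (C ∘ h) r c
    G-resp : Respects≗ G
    G-resp h≗h′ = cong (λ M → M r c) (φ-cong k (cong C ∘ h≗h′))

corollaryB3 : (n k : ℕ) → 2 ≤ k
    → (𝓗 : Mat n → Set) → (∀ A → 𝓗 A → IsUT A)
    → (C : Fin (suc k) → Mat n)
    → (∀ i → InL≥ (Log 𝓗) 1 (C i))
    → InL≥ (Log 𝓗) 2 (sumFinₘ (suc k) C)
    → (s : Fin k → Fin (suc k)) → HasSingletonBlock s
    → InL≥ (Log 𝓗) (suc k) (coarseningSum k C s)
corollaryB3 n k _ 𝓗 _ C C∈ ∑C∈ s (l , singleton) =
  InL≥-≈ (Log 𝓗) (coarseningSum≈free-label C s l singleton)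
    (Span-sumₘ _ (All.universal (λ f → Span-· (𝟙 (anchored f)) (φ-sum-over-label (Log 𝓗) C C∈ ∑C∈ f l))
                                (allFuns k (suc k))))
  where open SingletonBlock s l singleton using (anchored)
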